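{- Let $n\geq 1$ and $r\geq 0$ be integers, let $n_0$ be the largest divisor of $n$ that is coprime to $\binom{n+r}{r}$, and let $L_n^{\langle r\rangle}(x)=\sum_{j=0}^{n}\binom{n-j+r}{n-j}\frac{x^j}{j!}$. If there is a prime $p$ satisfying $$\max\!\left(\frac{n+r}{2},\,n-n_0\right)<p\leq n,$$ then $L_n^{\langle r\rangle}(x)$ is irreducible over $\mathbb{Q}$. -}

module Defs where

open import Data.Nat as ℕ using (ℕ; zero; suc; _∸_; _≤_; _<_; _!)
open import Data.Nat.Properties using (_!≢0)
open import Data.Nat.Combinatorics using (_C_)
open import Data.Nat.Divisibility using (_∣_)
open import Data.Nat.Coprimality using (Coprime)
open import Data.Integer using (+_)
open import Data.Rational as ℚ using (ℚ; 0ℚ)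
open import Data.List using (List; []; _∷_; map; upTo)
open import Data.Product using (∃; _×_)
open import Data.Sum using (_⊎_)
open import Relation.Binary.PropositionalEquality using (_≡_; _≢_)

-- Univariate polynomials over ℚ, as coefficient lists (constant term
-- first).  Two lists represent the same polynomial iff all their
-- coefficients agree (trailing zeros are irrelevant).

Poly : Set
Poly = List ℚ

coeff : Poly → ℕ → ℚ
coeff []       _       = 0ℚ
coeff (a ∷ f)  zero    = a
coeff (a ∷ f)  (suc i) = coeff f i

_≈ₚ_ : Poly → Poly → Set
f ≈ₚ g = ∀ i → coeff f i ≡ coeff g i

_+ₚ_ : Poly → Poly → Poly
[]      +ₚ g       = g
(a ∷ f) +ₚ []      = a ∷ f
(a ∷ f) +ₚ (b ∷ g) = (a ℚ.+ b) ∷ (f +ₚ g)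

_*ₚ_ : Poly → Poly → Poly
[]      *ₚ g = []
(a ∷ f) *ₚ g = map (a ℚ.*_) g +ₚ (0ℚ ∷ (f *ₚ g))

IsConstant : Poly → Set
IsConstant f = ∀ i → 1 ≤ i → coeff f i ≡ 0ℚ

-- Irreducible over ℚ: f is nonconstant (so nonzero and not a unit of ℚ[x])
-- and every factorisation f = g * h in ℚ[x] has a constant factor
-- (a unit, since g, h are then necessarily nonzero).
Irreducible : Poly → Set
Irreducible f =
  (∃ λ i → 1 ≤ i × coeff f i ≢ 0ℚ) ×
  (∀ g h → f ≈ₚ (g *ₚ h) → IsConstant g ⊎ IsConstant h)

Lcoeff : ℕ → ℕ → ℕ → ℚ
Lcoeff n r j = ((+ ((n ∸ j ℕ.+ r) C (n ∸ j))) ℚ./ (j !)) {{j !≢0}}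

L : ℕ → ℕ → Poly
L n r = map (Lcoeff n r) (upTo (suc n))

IsLargestCoprimeDivisor : ℕ → ℕ → ℕ → Set
IsLargestCoprimeDivisor n r n₀ =
  n₀ ∣ n × Coprime n₀ ((n ℕ.+ r) C r) ×
  (∀ d → d ∣ n → Coprime d ((n ℕ.+ r) C r) → d ≤ n₀)

{-# OPTIONS --safe #-}
-- Both halves of the argument use Newton polygons in the form of Dumas' theorem: for a
-- prime q and a slope −A/B, the leftmost and the rightmost coefficient minimising
-- B·ν_q(c_j) + A·j are additive under multiplication of polynomials.  For the
-- coefficients c_j = C(n−j+r, n−j)/j! of L, Legendre's formula (q−1)·ν_q(j!) = j − s_q(j),
-- with s_q the base-q digit sum, makes these weights explicit.
--
-- If q ∤ C(n+r, r), adding n and r in base q has no carries (Kummer), and the q-adic Newton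
-- polygon of L has its vertices at J_k = ⌊n/q^k⌋·q^k; the edge from J_(k+1) to J_k has slope
-- −(q^k − 1)/((q − 1)·q^k), and as q^k − 1 is prime to q^k, the part of that edge owned by a
-- factor has length divisible by q^k.  Summing over k ≥ e gives q^e ∣ deg g for every factor g
-- when q^e ∣ n, hence n₀ divides the degree of every factor.
--
-- For the prime p with (n+r)/2 < p ≤ n, ν_p(c_0) = 0, ν_p(c_j) ≥ 0 for j < p and ν_p(c_j) ≥ −1
-- always.  If k ≥ p is the first index with ν_p(c_k) = −1, the segment from (0, 0) to (k, −1)
-- is an edge without interior lattice points, so one factor owns all of it and has degree ≥ p.
-- The other factor has degree ≤ n − p < n₀ and divisible by n₀, so it is constant.

module Submission where

open import Defs
open import Data.Integer as ℤ using (ℤ; +_; -[1+_]; +[1+_])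
import Data.Integer.Divisibility.Signed as ℤD
import Data.Integer.GCD as ℤ
import Data.Integer.Properties as ℤP
import Data.Integer.Tactic.RingSolver as ℤ-Ring
open import Data.List using ([]; _∷_; map; length; applyUpTo)
open import Data.List.Relation.Unary.All using (_∷_)
open import Data.Nat
open import Data.Nat.Combinatorics using (_C_; nCk≡n!/k![n-k]!; k![n∸k]!∣n!; nCk≡nC[n∸k])
open import Data.Nat.Coprimality using (Coprime)
open import Data.Nat.Divisibility
open import Data.Nat.DivMod
open import Data.Nat.Induction using (<-rec)
open import Data.Nat.ListAction using (product)
open import Data.Nat.Primality using (Prime; euclidsLemma; prime⇒nonZero; prime⇒nonTrivial)
open import Data.Nat.Primality.Factorisation using (factorise; PrimeFactorisation)
open import Data.Nat.Properties
open import Data.Nat.Tactic.RingSolver using (solve-∀)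
open import Data.Product using (∃; ∃₂; _×_; _,_; proj₁; proj₂)
open import Data.Rational as ℚ using (ℚ; mkℚ; 0ℚ; ↥_; ↧_; ↧ₙ_)
import Data.Rational.Properties as ℚP
open import Algebra.Properties.Group ℚP.+-0-group using (inverseʳ-unique; ⁻¹-involutive)
import Data.Sum
open import Data.Sum using (_⊎_; inj₁; inj₂; [_,_]′)
open import Function using (_∘_)
open import Relation.Binary.Definitions using (tri<; tri≈; tri>)
open import Relation.Binary.PropositionalEquality
open import Relation.Nullary using (¬_; Dec; yes; no; contradiction)
open import Relation.Nullary.Decidable using (decidable-stable)

private
  [m+o]-[n+o]≡m-n : ∀ m n o → + (m + o) ℤ.- + (n + o) ≡ + m ℤ.- + n
  [m+o]-[n+o]≡m-n m n o = trans (cong₂ ℤ._-_ (ℤP.pos-+ m o) (ℤP.pos-+ n o)) (ring (+ m) (+ n) (+ o))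
    where
    ring : ∀ m n o → (m ℤ.+ o) ℤ.- (n ℤ.+ o) ≡ m ℤ.- n
    ring = ℤ-Ring.solve-∀

  [m+n]-[o+p]≡[m-o]+[n-p] : ∀ m n o p → + (m + n) ℤ.- + (o + p) ≡ (+ m ℤ.- + o) ℤ.+ (+ n ℤ.- + p)
  [m+n]-[o+p]≡[m-o]+[n-p] m n o p = trans (cong₂ ℤ._-_ (ℤP.pos-+ m n) (ℤP.pos-+ o p)) (ring (+ m) (+ n) (+ o) (+ p))
    where
    ring : ∀ m n o p → (m ℤ.+ n) ℤ.- (o ℤ.+ p) ≡ (m ℤ.- o) ℤ.+ (n ℤ.- p)
    ring = ℤ-Ring.solve-∀

  i≤j-k⇒i+k≤j : ∀ {i j} k → i ℤ.≤ j ℤ.- k → i ℤ.+ k ℤ.≤ j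
  i≤j-k⇒i+k≤j {i} {j} k h = subst (i ℤ.+ k ℤ.≤_) (ring j k) (ℤP.+-monoˡ-≤ k h)
    where
    ring : ∀ j k → j ℤ.- k ℤ.+ k ≡ j
    ring = ℤ-Ring.solve-∀

  i+k≤j⇒i≤j-k : ∀ {i j} k → i ℤ.+ k ℤ.≤ j → i ℤ.≤ j ℤ.- k
  i+k≤j⇒i≤j-k {i} {j} k h = subst (ℤ._≤ j ℤ.- k) (ring i k) (ℤP.+-monoˡ-≤ (ℤ.- k) h)
    where
    ring : ∀ i k → i ℤ.+ k ℤ.- k ≡ i
    ring = ℤ-Ring.solve-∀

  i+k<j+k⇒i<j : ∀ {i j} k → i ℤ.+ k ℤ.< j ℤ.+ k → i ℤ.< j
  i+k<j+k⇒i<j {i} {j} k h = subst₂ ℤ._<_ (ring i k) (ring j k) (ℤP.+-monoˡ-< (ℤ.- k) h)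
    where
    ring : ∀ i k → i ℤ.+ k ℤ.- k ≡ i
    ring = ℤ-Ring.solve-∀

  m+p≤n+o⇒m-o≤n-p : ∀ {m n o p} → m + p ≤ n + o → + m ℤ.- + o ℤ.≤ + n ℤ.- + p
  m+p≤n+o⇒m-o≤n-p {m} {n} {o} {p} h =
    subst₂ ℤ._≤_ ([m+o]-[n+o]≡m-n m o p) (trans (cong (λ z → + (n + o) ℤ.- + z) (+-comm o p)) ([m+o]-[n+o]≡m-n n p o))
      (ℤP.+-monoˡ-≤ (ℤ.- + (o + p)) (ℤ.+≤+ h))

  m+p<n+o⇒m-o<n-p : ∀ {m n o p} → m + p < n + o → + m ℤ.- + o ℤ.< + n ℤ.- + p
  m+p<n+o⇒m-o<n-p {m} {n} {o} {p} h =
    ℤP.suc[i]≤j⇒i<j (subst (ℤ._≤ + n ℤ.- + p) (ℤP.+-assoc (+ 1) (+ m) (ℤ.- + o)) (m+p≤n+o⇒m-o≤n-p {suc m} {n} {o} {p} h))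

  m+p≡n+o⇒m-o≡n-p : ∀ {m n o p} → m + p ≡ n + o → + m ℤ.- + o ≡ + n ℤ.- + p
  m+p≡n+o⇒m-o≡n-p {m} {n} {o} {p} eq =
    ℤP.≤-antisym (m+p≤n+o⇒m-o≤n-p {m} {n} {o} {p} (≤-reflexive eq)) (m+p≤n+o⇒m-o≤n-p {n} {m} {p} {o} (≤-reflexive (sym eq)))

∑≤ : ℕ → (ℕ → ℚ) → ℚ
∑≤ zero f = f 0
∑≤ (suc K) f = ∑≤ K f ℚ.+ f (suc K)

_⋆_ : (ℕ → ℚ) → (ℕ → ℚ) → ℕ → ℚ
(g ⋆ h) K = ∑≤ K (λ i → g i ℚ.* h (K ∸ i))

∑≤-shift : ∀ K f → ∑≤ (suc K) f ≡ f 0 ℚ.+ ∑≤ K (f ∘ suc)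
∑≤-shift zero f = refl
∑≤-shift (suc K) f = trans (cong (ℚ._+ f (suc (suc K))) (∑≤-shift K f)) (ℚP.+-assoc (f 0) _ _)

∑≤-zero : ∀ K f → (∀ i → f i ≡ 0ℚ) → ∑≤ K f ≡ 0ℚ
∑≤-zero zero f f≡0 = f≡0 0
∑≤-zero (suc K) f f≡0 = trans (cong₂ ℚ._+_ (∑≤-zero K f f≡0) (f≡0 (suc K))) (ℚP.+-identityˡ 0ℚ)

coeff-+ₚ : ∀ f g i → coeff (f +ₚ g) i ≡ coeff f i ℚ.+ coeff g i
coeff-+ₚ [] g i = sym (ℚP.+-identityˡ _)
coeff-+ₚ (a ∷ f) [] i = sym (ℚP.+-identityʳ _)
coeff-+ₚ (a ∷ f) (b ∷ g) zero = refl
coeff-+ₚ (a ∷ f) (b ∷ g) (suc i) = coeff-+ₚ f g i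

coeff-map-* : ∀ a g i → coeff (map (a ℚ.*_) g) i ≡ a ℚ.* coeff g i
coeff-map-* a [] i = sym (ℚP.*-zeroʳ a)
coeff-map-* a (b ∷ g) zero = refl
coeff-map-* a (b ∷ g) (suc i) = coeff-map-* a g i

coeff-*ₚ : ∀ g h K → coeff (g *ₚ h) K ≡ (coeff g ⋆ coeff h) K
coeff-*ₚ [] h K = sym (∑≤-zero K _ (λ i → ℚP.*-zeroˡ (coeff h (K ∸ i))))
coeff-*ₚ (a ∷ g) h zero = trans (coeff-+ₚ (map (a ℚ.*_) h) (0ℚ ∷ (g *ₚ h)) 0)
  (trans (cong (ℚ._+ 0ℚ) (coeff-map-* a h 0)) (ℚP.+-identityʳ _))
coeff-*ₚ (a ∷ g) h (suc K) = trans (coeff-+ₚ (map (a ℚ.*_) h) (0ℚ ∷ (g *ₚ h)) (suc K))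
  (trans (cong₂ ℚ._+_ (coeff-map-* a h (suc K)) (coeff-*ₚ g h K))
    (sym (∑≤-shift K (λ i → coeff (a ∷ g) i ℚ.* coeff h (suc K ∸ i)))))

coeff-≥length : ∀ g {j} → length g ≤ j → coeff g j ≡ 0ℚ
coeff-≥length [] _ = refl
coeff-≥length (a ∷ g) {suc j} (s≤s h) = coeff-≥length g h

IsDegree : (ℕ → ℚ) → ℕ → Set
IsDegree P d = P d ≢ 0ℚ × (∀ j → d < j → P j ≡ 0ℚ)

IsDegree-unique : ∀ {P d d′} → IsDegree P d → IsDegree P d′ → d ≡ d′
IsDegree-unique {d = d} {d′} (Pd≢0 , above) (Pd′≢0 , above′) with <-cmp d d′
... | tri< d<d′ _ _ = contradiction (above d′ d<d′) Pd′≢0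
... | tri≈ _ d≡d′ _ = d≡d′
... | tri> _ _ d′<d = contradiction (above′ d d′<d) Pd≢0

nonzero-or-vanishing : ∀ (P : ℕ → ℚ) N → (∃ λ j → P j ≢ 0ℚ) ⊎ (∀ j → j < N → P j ≡ 0ℚ)
nonzero-or-vanishing P zero = inj₂ (λ _ ())
nonzero-or-vanishing P (suc N) with nonzero-or-vanishing P N | P N ℚ.≟ 0ℚ
... | inj₁ nonzero | _ = inj₁ nonzero
... | inj₂ _ | no PN≢0 = inj₁ (N , PN≢0)
... | inj₂ vanishing | yes PN≡0 = inj₂ (λ j j<1+N → [ vanishing j , (λ { refl → PN≡0 }) ]′ (m<1+n⇒m<n∨m≡n j<1+N))

IsDegree-cong : ∀ {P P′ d} → (∀ j → P j ≡ P′ j) → IsDegree P d → IsDegree P′ d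
IsDegree-cong {d = d} P≗P′ (Pd≢0 , above) = Pd≢0 ∘ trans (P≗P′ d) , λ j d<j → trans (sym (P≗P′ j)) (above j d<j)

≤-degree : ∀ {P d j} → IsDegree P d → P j ≢ 0ℚ → j ≤ d
≤-degree {j = j} (_ , above) Pj≢0 = ≮⇒≥ (Pj≢0 ∘ above j)

-- p-adic valuations

nonZero-↥ : ∀ {x} → x ≢ 0ℚ → ℤ.NonZero (↥ x)
nonZero-↥ {x} x≢0 = ℤ.≢-nonZero (x≢0 ∘ ℚP.↥p≡0⇒p≡0 x)

/≡0⇒≡0 : ∀ i n .{{_ : NonZero n}} → i ℚ./ n ≡ 0ℚ → i ≡ + 0
/≡0⇒≡0 i n i/n≡0 = trans (sym (ℚP.↥-/ i n)) (trans (cong (λ z → ↥ z ℤ.* ℤ.gcd i (+ n)) i/n≡0) (ℤP.*-zeroˡ (ℤ.gcd i (+ n))))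

*-≢0 : ∀ {x y} → x ≢ 0ℚ → y ≢ 0ℚ → x ℚ.* y ≢ 0ℚ
*-≢0 {x@(mkℚ a d-1 _)} {y@(mkℚ b e-1 _)} x≢0 y≢0 x*y≡0 with ℤP.i*j≡0⇒i≡0∨j≡0 a (/≡0⇒≡0 (a ℤ.* b) (suc d-1 * suc e-1) x*y≡0)
... | inj₁ a≡0 = x≢0 (ℚP.↥p≡0⇒p≡0 x a≡0)
... | inj₂ b≡0 = y≢0 (ℚP.↥p≡0⇒p≡0 y b≡0)

module Valuation {q : ℕ} (q-prime : Prime q) where

  instance
    q≢0 : NonZero q
    q≢0 = prime⇒nonZero q-prime

  1<q : 1 < q
  1<q = nonTrivial⇒n>1 q {{prime⇒nonTrivial q-prime}}

  q∤1 : ¬ q ∣ 1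
  q∤1 q∣1 = <⇒≢ 1<q (sym (∣1⇒≡1 q∣1))

  q^-mono-∣ : ∀ {m n} → m ≤ n → q ^ m ∣ q ^ n
  q^-mono-∣ {m} {n} m≤n = divides (q ^ (n ∸ m))
    (trans (cong (q ^_) (sym (m∸n+n≡m m≤n))) (^-distribˡ-+-* q (n ∸ m) m))

  PowerSplit : ℕ → Set
  PowerSplit m = ∃₂ λ k u → m ≡ q ^ k * u × ¬ q ∣ u

  private
    powerSplit : ∀ fuel m → m < fuel → .{{NonZero m}} → PowerSplit m
    powerSplit (suc fuel) m (s≤s m≤fuel) with q ∣? m
    ... | no q∤m = 0 , m , sym (*-identityˡ m) , q∤m
    ... | yes (divides t refl) with powerSplit fuel t (<-≤-trans (m<m*n t q {{m*n≢0⇒m≢0 t}} 1<q) m≤fuel) {{m*n≢0⇒m≢0 t}}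
    ...   | k , u , refl , q∤u = suc k , u , rearrange (q ^ k) u q , q∤u
      where
      rearrange : ∀ a b c → (a * b) * c ≡ (c * a) * b
      rearrange = solve-∀

  -- ν 0 = 0 is a junk value.
  opaque
    ν : ℕ → ℕ
    ν zero = 0
    ν m@(suc _) = proj₁ (powerSplit (suc m) m ≤-refl)

    ν-split : ∀ m .{{_ : NonZero m}} → ∃ λ u → m ≡ q ^ ν m * u × ¬ q ∣ u
    ν-split m@(suc _) = proj₂ (powerSplit (suc m) m ≤-refl)

  private
    exponent-unique : ∀ k k′ {u u′} → q ^ k * u ≡ q ^ k′ * u′ → ¬ q ∣ u → ¬ q ∣ u′ → k ≡ k′
    exponent-unique zero zero _ _ _ = refl
    exponent-unique zero (suc k′) {u} {u′} eq q∤u _ =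
      contradiction (divides (q ^ k′ * u′) (trans (sym (*-identityˡ u)) (trans eq (ring q (q ^ k′) u′)))) q∤u
      where
      ring : ∀ a b c → (a * b) * c ≡ (b * c) * a
      ring = solve-∀
    exponent-unique (suc k) zero eq q∤u q∤u′ = sym (exponent-unique zero (suc k) (sym eq) q∤u′ q∤u)
    exponent-unique (suc k) (suc k′) {u} {u′} eq q∤u q∤u′ =
      cong suc (exponent-unique k k′ (*-cancelˡ-≡ _ _ q (trans (sym (*-assoc q (q ^ k) u)) (trans eq (*-assoc q (q ^ k′) u′)))) q∤u q∤u′)

  ν-unique : ∀ {m k u} → m ≡ q ^ k * u → ¬ q ∣ u → ν m ≡ k
  ν-unique {zero} {k} {u} eq q∤u with m*n≡0⇒m≡0∨n≡0 (q ^ k) (sym eq)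
  ... | inj₁ q^k≡0 = contradiction q^k≡0 (≢-nonZero⁻¹ (q ^ k) {{m^n≢0 q k}})
  ... | inj₂ refl = contradiction (q ∣0) q∤u
  ν-unique {m@(suc _)} eq q∤u with ν-split m
  ... | u′ , eq′ , q∤u′ = exponent-unique _ _ (trans (sym eq′) eq) q∤u′ q∤u

  ν≡0 : ∀ {m} → ¬ q ∣ m → ν m ≡ 0
  ν≡0 {m} = ν-unique (sym (*-identityˡ m))

  ν[1] : ν 1 ≡ 0
  ν[1] = ν≡0 q∤1

  ν-* : ∀ m n .{{_ : NonZero m}} .{{_ : NonZero n}} → ν (m * n) ≡ ν m + ν n
  ν-* m n with ν-split m | ν-split n
  ... | u , m≡ , q∤u | u′ , n≡ , q∤u′ = ν-unique eq q∤uu′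
    where
    rearrange : ∀ a u b u′ → (a * u) * (b * u′) ≡ (a * b) * (u * u′)
    rearrange = solve-∀
    eq : m * n ≡ q ^ (ν m + ν n) * (u * u′)
    eq = trans (cong₂ _*_ m≡ n≡) (trans (rearrange (q ^ ν m) u (q ^ ν n) u′)
           (cong (_* (u * u′)) (sym (^-distribˡ-+-* q (ν m) (ν n)))))
    q∤uu′ : ¬ q ∣ u * u′
    q∤uu′ q∣uu′ with euclidsLemma u u′ q-prime q∣uu′
    ... | inj₁ q∣u = q∤u q∣u
    ... | inj₂ q∣u′ = q∤u′ q∣u′

  ν[q]≡1 : ν q ≡ 1
  ν[q]≡1 = ν-unique (sym (trans (*-identityʳ (q * 1)) (*-identityʳ q))) q∤1

  ν-q* : ∀ m .{{_ : NonZero m}} → ν (q * m) ≡ suc (ν m)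
  ν-q* m = trans (ν-* q m) (cong (_+ ν m) ν[q]≡1)

  q^ν∣ : ∀ m → q ^ ν m ∣ m
  q^ν∣ zero = _ ∣0
  q^ν∣ m@(suc _) with ν-split m
  ... | u , eq , _ = divides u (trans eq (*-comm _ u))

  q^k∣⇒k≤ν : ∀ {m k} .{{_ : NonZero m}} → q ^ k ∣ m → k ≤ ν m
  q^k∣⇒k≤ν {m} {k} q^k∣m with k ≤? ν m | ν-split m
  ... | yes k≤ν | _ = k≤ν
  ... | no k≰ν | u , eq , q∤u = contradiction q∣u q∤u
    where
    q^[1+ν]∣m : q ^ ν m * q ∣ q ^ ν m * u
    q^[1+ν]∣m = subst₂ _∣_ (trans (cong (q ^_) (+-comm 1 (ν m))) (trans (^-distribˡ-+-* q (ν m) 1) (cong (q ^ ν m *_) (*-identityʳ q)))) eq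
                  (∣-trans (q^-mono-∣ (≰⇒> k≰ν)) q^k∣m)
    q∣u : q ∣ u
    q∣u = *-cancelˡ-∣ (q ^ ν m) {{m^n≢0 q (ν m)}} q^[1+ν]∣m

  νℤ : ℤ → ℕ
  νℤ z = ν ℤ.∣ z ∣

  νℤ-* : ∀ a b .{{_ : ℤ.NonZero a}} .{{_ : ℤ.NonZero b}} → νℤ (a ℤ.* b) ≡ νℤ a + νℤ b
  νℤ-* a b = trans (cong ν (ℤP.abs-* a b)) (ν-* ℤ.∣ a ∣ ℤ.∣ b ∣)

  νℤ-+ : ∀ {T} a b .{{_ : ℤ.NonZero (a ℤ.+ b)}} → T ℤ.≤ + νℤ a → T ℤ.≤ + νℤ b → T ℤ.≤ + νℤ (a ℤ.+ b)
  νℤ-+ { -[1+ _ ]} _ _ _ _ = ℤ.-≤+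
  νℤ-+ {+ t} a b (ℤ.+≤+ t≤νa) (ℤ.+≤+ t≤νb) =
    ℤ.+≤+ (q^k∣⇒k≤ν (ℤD.∣⇒∣ᵤ (ℤD.∣m∣n⇒∣m+n (q^t∣ a t≤νa) (q^t∣ b t≤νb))))
    where
    q^t∣ : ∀ z → t ≤ νℤ z → (+ (q ^ t)) ℤD.∣ z
    q^t∣ z t≤νz = ℤD.∣ᵤ⇒∣ (∣-trans (q^-mono-∣ t≤νz) (q^ν∣ ℤ.∣ z ∣))

  ν-factors : ∀ a c {b} → a * c ≡ b → .{{_ : NonZero b}} → ν a + ν c ≡ ν b
  ν-factors a c refl = sym (ν-* a c {{m*n≢0⇒m≢0 a}} {{m*n≢0⇒n≢0 a}})

  ν-mono-∣ : ∀ {m n} .{{_ : NonZero n}} → m ∣ n → ν m ≤ ν n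
  ν-mono-∣ {m} {n} (divides t n≡t*m) = subst (ν m ≤_) (ν-factors t m (sym n≡t*m)) (m≤n+m (ν m) (ν t))

  νℚ : ℚ → ℤ
  νℚ x = + νℤ (↥ x) ℤ.- + ν (↧ₙ x)

  νℚ-/ : ∀ i n .{{_ : NonZero n}} .{{_ : ℤ.NonZero i}} → νℚ (i ℚ./ n) ≡ + νℤ i ℤ.- + ν n
  νℚ-/ i n = trans (sym ([m+o]-[n+o]≡m-n (νℤ (↥ (i ℚ./ n))) (ν (↧ₙ (i ℚ./ n))) (ν ℤ.∣ g ∣)))
                   (cong₂ (λ a b → + a ℤ.- + b) (ν-factors ℤ.∣ ↥ (i ℚ./ n) ∣ ℤ.∣ g ∣ numerator) (ν-factors (↧ₙ (i ℚ./ n)) ℤ.∣ g ∣ denominator))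
    where
    g : ℤ
    g = ℤ.gcd i (+ n)
    numerator : ℤ.∣ ↥ (i ℚ./ n) ∣ * ℤ.∣ g ∣ ≡ ℤ.∣ i ∣
    numerator = trans (sym (ℤP.abs-* (↥ (i ℚ./ n)) g)) (cong ℤ.∣_∣ (ℚP.↥-/ i n))
    denominator : ↧ₙ (i ℚ./ n) * ℤ.∣ g ∣ ≡ n
    denominator = trans (sym (ℤP.abs-* (↧ (i ℚ./ n)) g)) (cong ℤ.∣_∣ (ℚP.↧-/ i n))

  νℚ-* : ∀ x y → x ≢ 0ℚ → y ≢ 0ℚ → νℚ (x ℚ.* y) ≡ νℚ x ℤ.+ νℚ y
  νℚ-* x@(mkℚ a d-1 _) y@(mkℚ b e-1 _) x≢0 y≢0 = begin
    νℚ ((a ℤ.* b) ℚ./ (suc d-1 * suc e-1))                   ≡⟨ νℚ-/ (a ℤ.* b) _ ⟩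
    + νℤ (a ℤ.* b) ℤ.- + ν (suc d-1 * suc e-1)                ≡⟨ cong₂ (λ s t → + s ℤ.- + t) (νℤ-* a b) (ν-* (suc d-1) (suc e-1)) ⟩
    + (νℤ a + νℤ b) ℤ.- + (ν (suc d-1) + ν (suc e-1))         ≡⟨ [m+n]-[o+p]≡[m-o]+[n-p] (νℤ a) (νℤ b) (ν (suc d-1)) (ν (suc e-1)) ⟩
    νℚ x ℤ.+ νℚ y                                              ∎
    where
    open ≡-Reasoning
    instance
      _ = nonZero-↥ x≢0
      _ = nonZero-↥ y≢0
      _ = ℤP.i*j≢0 a b

  νℚ-neg : ∀ x → νℚ (ℚ.- x) ≡ νℚ x
  νℚ-neg (mkℚ -[1+ _ ] _ _) = refl
  νℚ-neg (mkℚ (+ 0) _ _) = refl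
  νℚ-neg (mkℚ +[1+ _ ] _ _) = refl

  νℚ-+ : ∀ {T} x y → x ≢ 0ℚ → y ≢ 0ℚ → x ℚ.+ y ≢ 0ℚ → T ℤ.≤ νℚ x → T ℤ.≤ νℚ y → T ℤ.≤ νℚ (x ℚ.+ y)
  νℚ-+ {T} x@(mkℚ a d-1 _) y@(mkℚ b e-1 _) x≢0 y≢0 x+y≢0 T≤νx T≤νy =
    subst (T ℤ.≤_) (sym (trans (cong νℚ x+y≡) (νℚ-/ N D)))
      (i+k≤j⇒i≤j-k (+ ν D) (νℤ-+ A B (i≤j-k⇒i+k≤j (+ ν D) (subst (T ℤ.≤_) νx≡ T≤νx)) (i≤j-k⇒i+k≤j (+ ν D) (subst (T ℤ.≤_) νy≡ T≤νy))))
    where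
    d e : ℕ
    d = suc d-1
    e = suc e-1
    A B N : ℤ
    A = a ℤ.* + e
    B = b ℤ.* + d
    N = A ℤ.+ B
    D : ℕ
    D = d * e
    x+y≡ : x ℚ.+ y ≡ N ℚ./ D
    x+y≡ = refl
    instance
      _ = nonZero-↥ x≢0
      _ = nonZero-↥ y≢0
      nonZero-N : ℤ.NonZero N
      nonZero-N = ℤ.≢-nonZero {N} (λ N≡0 → x+y≢0 (trans (cong (ℚ._/ D) N≡0) (ℚP.0/n≡0 D)))
    νx≡ : νℚ x ≡ + νℤ A ℤ.- + ν D
    νx≡ = trans (sym ([m+o]-[n+o]≡m-n (νℤ a) (ν d) (ν e))) (cong₂ (λ s t → + s ℤ.- + t) (sym (νℤ-* a (+ e))) (sym (ν-* d e)))
    νy≡ : νℚ y ≡ + νℤ B ℤ.- + ν D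
    νy≡ = trans (sym ([m+o]-[n+o]≡m-n (νℤ b) (ν e) (ν d)))
            (cong₂ (λ s t → + s ℤ.- + t) (sym (νℤ-* b (+ d))) (trans (+-comm (ν e) (ν d)) (sym (ν-* d e))))

  -- x = (x + y) + (− y), so a larger ν (x + y) would force ν x > ν x.
  νℚ-+-dominant : ∀ x y → x ≢ 0ℚ → y ≢ 0ℚ → νℚ x ℤ.< νℚ y → x ℚ.+ y ≢ 0ℚ × νℚ (x ℚ.+ y) ≡ νℚ x
  νℚ-+-dominant x y x≢0 y≢0 νx<νy = x+y≢0 , ℤP.≤-antisym (ℤP.≮⇒≥ νx≮νx+y) (νℚ-+ x y x≢0 y≢0 x+y≢0 ℤP.≤-refl (ℤP.<⇒≤ νx<νy))
    where
    x+y≢0 : x ℚ.+ y ≢ 0ℚ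
    x+y≢0 x+y≡0 = ℤP.<-irrefl (sym (trans (cong νℚ (inverseʳ-unique x y x+y≡0)) (νℚ-neg x))) νx<νy
    -y≢0 : ℚ.- y ≢ 0ℚ
    -y≢0 -y≡0 = y≢0 (trans (sym (⁻¹-involutive y)) (cong ℚ.-_ -y≡0))
    x+y-y≡x : (x ℚ.+ y) ℚ.+ ℚ.- y ≡ x
    x+y-y≡x = trans (ℚP.+-assoc x y (ℚ.- y)) (trans (cong (x ℚ.+_) (ℚP.+-inverseʳ y)) (ℚP.+-identityʳ x))
    νx≮νx+y : ¬ νℚ x ℤ.< νℚ (x ℚ.+ y)
    νx≮νx+y νx<νx+y = ℤP.<-irrefl refl (ℤP.suc[i]≤j⇒i<j (subst (ℤ.suc (νℚ x) ℤ.≤_) (cong νℚ x+y-y≡x)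
      (νℚ-+ (x ℚ.+ y) (ℚ.- y) x+y≢0 -y≢0 (subst (_≢ 0ℚ) (sym x+y-y≡x) x≢0)
        (ℤP.i<j⇒suc[i]≤j νx<νx+y) (subst (ℤ.suc (νℚ x) ℤ.≤_) (sym (νℚ-neg y)) (ℤP.i<j⇒suc[i]≤j νx<νy)))))

  ∑≤-closed : (R : ℤ → Set) → (∀ {a b} → R a → a ℤ.≤ b → R b) → ∀ K f →
              (∀ i → i ≤ K → f i ≡ 0ℚ ⊎ R (νℚ (f i))) → ∑≤ K f ≡ 0ℚ ⊎ R (νℚ (∑≤ K f))
  ∑≤-closed R R-up zero f bound = bound 0 z≤n
  ∑≤-closed R R-up (suc K) f bound =
    +-closed (∑≤ K f) (f (suc K)) (∑≤-closed R R-up K f (λ i i≤K → bound i (m≤n⇒m≤1+n i≤K))) (bound (suc K) ≤-refl)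
    where
    +-closed : ∀ x y → x ≡ 0ℚ ⊎ R (νℚ x) → y ≡ 0ℚ ⊎ R (νℚ y) → x ℚ.+ y ≡ 0ℚ ⊎ R (νℚ (x ℚ.+ y))
    +-closed x y (inj₁ refl) Ry = subst (λ z → z ≡ 0ℚ ⊎ R (νℚ z)) (sym (ℚP.+-identityˡ y)) Ry
    +-closed x y Rx (inj₁ refl) = subst (λ z → z ≡ 0ℚ ⊎ R (νℚ z)) (sym (ℚP.+-identityʳ x)) Rx
    +-closed x y (inj₂ Rx) (inj₂ Ry) with x ℚ.+ y ℚ.≟ 0ℚ | x ℚ.≟ 0ℚ | y ℚ.≟ 0ℚ
    ... | yes x+y≡0 | _ | _ = inj₁ x+y≡0
    ... | no _ | yes refl | _ = inj₂ (subst (R ∘ νℚ) (sym (ℚP.+-identityˡ y)) Ry)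
    ... | no _ | no _ | yes refl = inj₂ (subst (R ∘ νℚ) (sym (ℚP.+-identityʳ x)) Rx)
    ... | no x+y≢0 | no x≢0 | no y≢0 with ℤP.≤-total (νℚ x) (νℚ y)
    ...   | inj₁ νx≤νy = inj₂ (R-up Rx (νℚ-+ x y x≢0 y≢0 x+y≢0 ℤP.≤-refl νx≤νy))
    ...   | inj₂ νy≤νx = inj₂ (R-up Ry (νℚ-+ x y x≢0 y≢0 x+y≢0 νy≤νx ℤP.≤-refl))

  private
    +-dominant : ∀ x y → x ≢ 0ℚ → y ≡ 0ℚ ⊎ νℚ x ℤ.< νℚ y → x ℚ.+ y ≢ 0ℚ × νℚ (x ℚ.+ y) ≡ νℚ x
    +-dominant x y x≢0 (inj₁ refl) = subst (λ z → z ≢ 0ℚ × νℚ z ≡ νℚ x) (sym (ℚP.+-identityʳ x)) (x≢0 , refl)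
    +-dominant x y x≢0 (inj₂ νx<νy) with y ℚ.≟ 0ℚ
    ... | yes refl = +-dominant x y x≢0 (inj₁ refl)
    ... | no y≢0 = νℚ-+-dominant x y x≢0 y≢0 νx<νy

  ∑≤-dominant : ∀ K f i₀ → i₀ ≤ K → f i₀ ≢ 0ℚ →
                (∀ i → i ≤ K → i ≢ i₀ → f i ≡ 0ℚ ⊎ νℚ (f i₀) ℤ.< νℚ (f i)) →
                ∑≤ K f ≢ 0ℚ × νℚ (∑≤ K f) ≡ νℚ (f i₀)
  ∑≤-dominant zero f .0 z≤n f[i₀]≢0 _ = f[i₀]≢0 , refl
  ∑≤-dominant (suc K) f i₀ i₀≤1+K f[i₀]≢0 others with i₀ ≟ suc K
  ... | yes refl = subst (λ z → z ≢ 0ℚ × νℚ z ≡ νℚ (f i₀)) (ℚP.+-comm (f i₀) (∑≤ K f))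
        (+-dominant (f i₀) (∑≤ K f) f[i₀]≢0
          (∑≤-closed (νℚ (f i₀) ℤ.<_) ℤP.<-≤-trans K f (λ i i≤K → others i (m≤n⇒m≤1+n i≤K) (<⇒≢ (s≤s i≤K)))))
  ... | no i₀≢1+K with ∑≤-dominant K f i₀ (≤-pred (≤∧≢⇒< i₀≤1+K i₀≢1+K)) f[i₀]≢0 (λ i i≤K → others i (m≤n⇒m≤1+n i≤K))
  ...   | ∑≢0 , ν∑≡ with +-dominant (∑≤ K f) (f (suc K)) ∑≢0 (dominated (others (suc K) ≤-refl (i₀≢1+K ∘ sym)))
    where
    dominated : f (suc K) ≡ 0ℚ ⊎ νℚ (f i₀) ℤ.< νℚ (f (suc K)) → f (suc K) ≡ 0ℚ ⊎ νℚ (∑≤ K f) ℤ.< νℚ (f (suc K))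
    dominated (inj₁ z) = inj₁ z
    dominated (inj₂ lt) = inj₂ (subst (ℤ._< _) (sym ν∑≡) lt)
  ...     | sum≢0 , ν-sum≡ = sum≢0 , trans ν-sum≡ ν∑≡

-- Digit sums: Legendre and Kummer

C[x+y,x]*x!*y!≡[x+y]! : ∀ x y → ((x + y) C x) * (x ! * y !) ≡ (x + y) !
C[x+y,x]*x!*y!≡[x+y]! x y = trans (cong (_* (x ! * y !)) (trans (nCk≡n!/k![n-k]! (m≤m+n x y)) (/-congʳ (cong (λ z → x ! * z !) (m+n∸m≡n x y)))))
  (m/n*n≡m (subst (λ z → x ! * z ! ∣ (x + y) !) (m+n∸m≡n x y) (k![n∸k]!∣n! (m≤m+n x y))))
  where instance
    _ = x !* y !≢0
    _ = x !* (x + y ∸ x) !≢0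

module DigitSum {q : ℕ} (q-prime : Prime q) where
  open Valuation q-prime

  q-1 : ℕ
  q-1 = q ∸ 1

  suc[q-1]≡q : suc q-1 ≡ q
  suc[q-1]≡q = m+[n∸m]≡n (<⇒≤ 1<q)

  private
    digitSumᶠ : ℕ → ℕ → ℕ
    digitSumᶠ zero _ = 0
    digitSumᶠ (suc fuel) m = m % q + digitSumᶠ fuel (m / q)

    digitSumᶠ[0] : ∀ fuel → digitSumᶠ fuel 0 ≡ 0
    digitSumᶠ[0] zero = refl
    digitSumᶠ[0] (suc fuel) = cong₂ _+_ (m*n%n≡0 0 q) (trans (cong (digitSumᶠ fuel) (0/n≡0 q)) (digitSumᶠ[0] fuel))

    digitSumᶠ-fuel : ∀ {f g} m → m < f → m < g → digitSumᶠ f m ≡ digitSumᶠ g m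
    digitSumᶠ-fuel {suc f} {suc g} zero _ _ = trans (digitSumᶠ[0] (suc f)) (sym (digitSumᶠ[0] (suc g)))
    digitSumᶠ-fuel {suc f} {suc g} m@(suc _) (s≤s m≤f) (s≤s m≤g) =
      cong (λ z → m % q + z) (digitSumᶠ-fuel (m / q) (<-≤-trans (m/n<m m q 1<q) m≤f) (<-≤-trans (m/n<m m q 1<q) m≤g))

  opaque
    digitSum : ℕ → ℕ
    digitSum m = digitSumᶠ (suc m) m

    digitSum[0] : digitSum 0 ≡ 0
    digitSum[0] = digitSumᶠ[0] 1

    digitSum-unfold : ∀ m → digitSum m ≡ m % q + digitSum (m / q)
    digitSum-unfold zero = trans (digitSumᶠ[0] 1) (sym (trans (cong₂ _+_ (m*n%n≡0 0 q) (cong digitSum (0/n≡0 q))) (digitSumᶠ[0] 1)))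
    digitSum-unfold m@(suc _) = cong (λ z → m % q + z) (digitSumᶠ-fuel (m / q) (m/n<m m q 1<q) ≤-refl)

  digitSum-+* : ∀ b X → b < q → digitSum (b + X * q) ≡ b + digitSum X
  digitSum-+* b X b<q = trans (digitSum-unfold (b + X * q)) (cong₂ _+_ rem≡ (cong digitSum quot≡))
    where
    rem≡ : (b + X * q) % q ≡ b
    rem≡ = trans ([m+kn]%n≡m%n b X q) (m<n⇒m%n≡m b<q)
    quot≡ : (b + X * q) / q ≡ X
    quot≡ = trans (+-distrib-/-∣ʳ b (n∣m*n X)) (cong₂ _+_ (m<n⇒m/n≡0 b<q) (m*n/n≡m X q))

  digitSum-+*q^ : ∀ k a N → a < q ^ k → digitSum (a + N * q ^ k) ≡ digitSum a + digitSum N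
  digitSum-+*q^ zero (suc a) N (s≤s ())
  digitSum-+*q^ zero zero N _ = trans (cong digitSum (*-identityʳ N)) (cong (_+ digitSum N) (sym digitSum[0]))
  digitSum-+*q^ (suc k) a N a<q^[1+k] = begin
    digitSum (a + N * (q * q ^ k))                ≡⟨ cong digitSum regroup ⟩
    digitSum (a % q + (a / q + N * q ^ k) * q)    ≡⟨ digitSum-+* (a % q) _ (m%n<n a q) ⟩
    a % q + digitSum (a / q + N * q ^ k)          ≡⟨ cong (λ z → a % q + z) (digitSum-+*q^ k (a / q) N a/q<q^k) ⟩
    a % q + (digitSum (a / q) + digitSum N)       ≡⟨ sym (+-assoc (a % q) _ _) ⟩
    (a % q + digitSum (a / q)) + digitSum N       ≡⟨ cong (_+ digitSum N) (sym (digitSum-unfold a)) ⟩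
    digitSum a + digitSum N                       ∎
    where
    open ≡-Reasoning
    a/q<q^k : a / q < q ^ k
    a/q<q^k = m<n*o⇒m/o<n (subst (a <_) (*-comm q (q ^ k)) a<q^[1+k])
    ring : ∀ r d N q Q → (r + d * q) + N * (q * Q) ≡ r + (d + N * Q) * q
    ring = solve-∀
    regroup : a + N * (q * q ^ k) ≡ a % q + (a / q + N * q ^ k) * q
    regroup = trans (cong (_+ N * (q * q ^ k)) (m≡m%n+[m/n]*n a q)) (ring (a % q) (a / q) N q (q ^ k))

  digitSum-*q^ : ∀ k N → digitSum (N * q ^ k) ≡ digitSum N
  digitSum-*q^ k N = trans (digitSum-+*q^ k 0 N (m^n>0 q k)) (cong (_+ digitSum N) digitSum[0])

  digitSum-suc : ∀ m → digitSum (suc m) + q-1 * ν (suc m) ≡ suc (digitSum m)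
  digitSum-suc = <-rec _ step
    where
    step : ∀ m → (∀ {k} → k < m → digitSum (suc k) + q-1 * ν (suc k) ≡ suc (digitSum k)) →
           digitSum (suc m) + q-1 * ν (suc m) ≡ suc (digitSum m)
    step m rec with suc (m % q) <? q
    ... | yes no-carry = begin
      digitSum (suc m) + q-1 * ν (suc m)             ≡⟨ cong (λ z → digitSum z + q-1 * ν z) suc[m]≡ ⟩
      digitSum (suc (m % q) + X * q) + q-1 * ν (suc (m % q) + X * q)
                                                     ≡⟨ cong₂ _+_ (digitSum-+* (suc (m % q)) X no-carry) (cong (q-1 *_) (ν≡0 q∤)) ⟩
      suc (m % q) + digitSum X + q-1 * 0             ≡⟨ cong (λ z → suc (m % q) + digitSum X + z) (*-zeroʳ q-1) ⟩
      suc (m % q + digitSum X) + 0                   ≡⟨ +-identityʳ _ ⟩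
      suc (m % q + digitSum X)                       ≡⟨ cong suc (sym (digitSum-unfold m)) ⟩
      suc (digitSum m)                               ∎
      where
      open ≡-Reasoning
      X : ℕ
      X = m / q
      suc[m]≡ : suc m ≡ suc (m % q) + X * q
      suc[m]≡ = cong suc (m≡m%n+[m/n]*n m q)
      q∤ : ¬ q ∣ suc (m % q) + X * q
      q∤ q∣ = 1+n≢0 (trans (sym (trans ([m+kn]%n≡m%n (suc (m % q)) X q) (m<n⇒m%n≡m no-carry))) (n∣m⇒m%n≡0 _ q q∣))
    ... | no carry = begin
      digitSum (suc m) + q-1 * ν (suc m)                   ≡⟨ cong₂ (λ a b → digitSum a + q-1 * ν b) suc[m]≡ (trans suc[m]≡ (*-comm (suc X) q)) ⟩
      digitSum (0 + suc X * q) + q-1 * ν (q * suc X)       ≡⟨ cong₂ _+_ (digitSum-+* 0 (suc X) (>-nonZero⁻¹ q)) (cong (q-1 *_) (ν-q* (suc X))) ⟩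
      digitSum (suc X) + q-1 * suc (ν (suc X))             ≡⟨ ring (digitSum (suc X)) q-1 (ν (suc X)) ⟩
      (digitSum (suc X) + q-1 * ν (suc X)) + q-1           ≡⟨ cong (_+ q-1) (rec X<m) ⟩
      suc (digitSum X) + q-1                               ≡⟨ +-comm (suc (digitSum X)) q-1 ⟩
      q-1 + suc (digitSum X)                               ≡⟨ +-suc q-1 (digitSum X) ⟩
      suc (q-1 + digitSum X)                               ≡⟨ cong (λ z → suc (z + digitSum X)) m%q≡q-1 ⟩
      suc (m % q + digitSum X)                             ≡⟨ cong suc (sym (digitSum-unfold m)) ⟩
      suc (digitSum m)                                     ∎
      where
      open ≡-Reasoning
      X : ℕ
      X = m / q
      suc[m%q]≡q : suc (m % q) ≡ q
      suc[m%q]≡q = ≤-antisym (m%n<n m q) (≮⇒≥ carry)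
      m%q≡q-1 : q-1 ≡ m % q
      m%q≡q-1 = suc-injective (trans suc[q-1]≡q (sym suc[m%q]≡q))
      suc[m]≡ : suc m ≡ 0 + suc X * q
      suc[m]≡ = trans (cong suc (m≡m%n+[m/n]*n m q)) (cong (_+ X * q) suc[m%q]≡q)
      m≢0 : m ≢ 0
      m≢0 refl = carry (subst (λ r → suc r < q) (sym (m*n%n≡0 0 q)) 1<q)
      X<m : X < m
      X<m = m/n<m m q {{≢-nonZero m≢0}} 1<q
      ring : ∀ s p v → s + p * suc v ≡ (s + p * v) + p
      ring = solve-∀

  legendre : ∀ m → q-1 * ν (m !) + digitSum m ≡ m
  legendre zero = cong₂ _+_ (trans (cong (q-1 *_) ν[1]) (*-zeroʳ q-1)) digitSum[0]
  legendre (suc m) = begin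
    q-1 * ν (suc m * m !) + digitSum (suc m)                ≡⟨ cong (λ z → q-1 * z + digitSum (suc m)) (ν-* (suc m) (m !) {{_}} {{m !≢0}}) ⟩
    q-1 * (ν (suc m) + ν (m !)) + digitSum (suc m)          ≡⟨ ring q-1 (ν (suc m)) (ν (m !)) (digitSum (suc m)) ⟩
    q-1 * ν (m !) + (digitSum (suc m) + q-1 * ν (suc m))    ≡⟨ cong (λ z → q-1 * ν (m !) + z) (digitSum-suc m) ⟩
    q-1 * ν (m !) + suc (digitSum m)                        ≡⟨ +-suc (q-1 * ν (m !)) (digitSum m) ⟩
    suc (q-1 * ν (m !) + digitSum m)                        ≡⟨ cong suc (legendre m) ⟩
    suc m                                                   ∎
    where
    open ≡-Reasoning
    ring : ∀ p a b s → p * (a + b) + s ≡ p * b + (s + p * a)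
    ring = solve-∀

  kummer : ∀ x y → q-1 * ν ((x + y) C x) + digitSum (x + y) ≡ digitSum x + digitSum y
  kummer x y = +-cancelʳ-≡ (q-1 * ν (x !) + q-1 * ν (y !)) _ _ (begin
    (q-1 * c + digitSum (x + y)) + (q-1 * ν (x !) + q-1 * ν (y !))  ≡⟨ ring₁ q-1 c (ν (x !)) (ν (y !)) (digitSum (x + y)) ⟩
    q-1 * (c + (ν (x !) + ν (y !))) + digitSum (x + y)              ≡⟨ cong (λ z → q-1 * z + digitSum (x + y)) νC+νx!+νy! ⟩
    q-1 * ν ((x + y) !) + digitSum (x + y)                          ≡⟨ legendre (x + y) ⟩
    x + y                                                           ≡⟨ cong₂ _+_ (sym (legendre x)) (sym (legendre y)) ⟩
    (q-1 * ν (x !) + digitSum x) + (q-1 * ν (y !) + digitSum y)     ≡⟨ ring₂ q-1 (ν (x !)) (ν (y !)) (digitSum x) (digitSum y) ⟩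
    (digitSum x + digitSum y) + (q-1 * ν (x !) + q-1 * ν (y !))     ∎)
    where
    open ≡-Reasoning
    instance
      _ = x !≢0
      _ = y !≢0
      _ = (x + y) !≢0
    c = ν ((x + y) C x)
    νC+νx!+νy! : c + (ν (x !) + ν (y !)) ≡ ν ((x + y) !)
    νC+νx!+νy! = trans (cong (λ z → c + z) (sym (ν-* (x !) (y !)))) (ν-factors ((x + y) C x) (x ! * y !) (C[x+y,x]*x!*y!≡[x+y]! x y))
    ring₁ : ∀ p c a b t → (p * c + t) + (p * a + p * b) ≡ p * (c + (a + b)) + t
    ring₁ = solve-∀
    ring₂ : ∀ p a b u w → (p * a + u) + (p * b + w) ≡ (u + w) + (p * a + p * b)
    ring₂ = solve-∀

  digitSum-+-≤ : ∀ x y → digitSum (x + y) ≤ digitSum x + digitSum y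
  digitSum-+-≤ x y = subst (digitSum (x + y) ≤_) (kummer x y) (m≤n+m (digitSum (x + y)) (q-1 * ν ((x + y) C x)))

  1≤q-1 : 1 ≤ q-1
  1≤q-1 = ≤-pred (subst (1 <_) (sym suc[q-1]≡q) 1<q)

  instance
    q-1≢0 : NonZero q-1
    q-1≢0 = >-nonZero 1≤q-1

  ν[!]-mono : ∀ {a b} → a ≤ b → ν (a !) ≤ ν (b !)
  ν[!]-mono {b = b} a≤b = ν-mono-∣ {{b !≢0}} (m≤n⇒m!∣n! a≤b)

  ν[!]-mono-< : ∀ {a b c} → a < b → b ≤ c → q ∣ b → ν (a !) < ν (c !)
  ν[!]-mono-< {a} {suc b} {c} (s≤s a≤b) b<c q∣b = begin-strict
    ν (a !)                    ≤⟨ ν[!]-mono a≤b ⟩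
    ν (b !)                    <⟨ m<n+m (ν (b !)) (q^k∣⇒k≤ν (subst (_∣ suc b) (sym (*-identityʳ q)) q∣b)) ⟩
    ν (suc b) + ν (b !)        ≡⟨ sym (ν-* (suc b) (b !) {{_}} {{b !≢0}}) ⟩
    ν (suc b !)                ≤⟨ ν[!]-mono b<c ⟩
    ν (c !)                    ∎
    where open ≤-Reasoning

  private
    legendre-swap : ∀ M N → (M + digitSum N) + q-1 * ν (N !) ≡ (N + digitSum M) + q-1 * ν (M !)
    legendre-swap M N = begin
      (M + digitSum N) + q-1 * ν (N !)                      ≡⟨ cong (λ z → (z + digitSum N) + q-1 * ν (N !)) (sym (legendre M)) ⟩
      (q-1 * ν (M !) + digitSum M + digitSum N) + q-1 * ν (N !)  ≡⟨ ring (q-1 * ν (M !)) (digitSum M) (digitSum N) (q-1 * ν (N !)) ⟩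
      (q-1 * ν (N !) + digitSum N + digitSum M) + q-1 * ν (M !)  ≡⟨ cong (λ z → (z + digitSum M) + q-1 * ν (M !)) (legendre N) ⟩
      (N + digitSum M) + q-1 * ν (M !)                      ∎
      where
      open ≡-Reasoning
      ring : ∀ a b c d → (a + b + c) + d ≡ (d + c + b) + a
      ring = solve-∀

  m+s[n]≤n+s[m] : ∀ {M N} → M ≤ N → M + digitSum N ≤ N + digitSum M
  m+s[n]≤n+s[m] {M} {N} M≤N = +-cancelʳ-≤ (q-1 * ν (N !)) _ _
    (subst (_≤ (N + digitSum M) + q-1 * ν (N !)) (sym (legendre-swap M N))
      (+-monoʳ-≤ (N + digitSum M) (*-monoʳ-≤ q-1 (ν[!]-mono M≤N))))

  m+s[n]<n+s[m] : ∀ {M N} → ν (M !) < ν (N !) → M + digitSum N < N + digitSum M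
  m+s[n]<n+s[m] {M} {N} νM!<νN! = +-cancelʳ-< (q-1 * ν (N !)) _ _
    (subst (_< (N + digitSum M) + q-1 * ν (N !)) (sym (legendre-swap M N))
      (+-monoʳ-< (N + digitSum M) (*-monoʳ-< q-1 νM!<νN!)))

  private
    q^[1+k]*digitSum : ∀ k t → q ^ suc k * digitSum t ≡ t % q * q ^ suc k + q ^ k * digitSum (t / q) * q
    q^[1+k]*digitSum k t = trans (cong (q ^ suc k *_) (digitSum-unfold t)) (ring (q ^ k) q (t % q) (digitSum (t / q)))
      where
      ring : ∀ Q q a b → (q * Q) * (a + b) ≡ a * (q * Q) + Q * b * q
      ring = solve-∀

  ≤q^k*digitSum : ∀ k t → t < q ^ k → t ≤ q ^ k * digitSum t
  ≤q^k*digitSum zero zero _ = z≤n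
  ≤q^k*digitSum zero (suc _) (s≤s ())
  ≤q^k*digitSum (suc k) t t<q^[1+k] = begin
    t                                                   ≡⟨ m≡m%n+[m/n]*n t q ⟩
    t % q + (t / q) * q                                 ≤⟨ +-mono-≤ (m≤m*n (t % q) (q ^ suc k) {{m^n≢0 q (suc k)}})
                                                                     (*-monoˡ-≤ q (≤q^k*digitSum k (t / q) (m<n*o⇒m/o<n (subst (t <_) (*-comm q (q ^ k)) t<q^[1+k])))) ⟩
    t % q * q ^ suc k + q ^ k * digitSum (t / q) * q  ≡⟨ sym (q^[1+k]*digitSum k t) ⟩
    q ^ suc k * digitSum t                              ∎
    where open ≤-Reasoning

  <q^k*digitSum : ∀ k t → 0 < t → t < q ^ k → t < q ^ k * digitSum t
  <q^k*digitSum zero (suc _) _ (s≤s ())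
  <q^k*digitSum (suc k) t 0<t t<q^[1+k] with t % q ≟ 0
  ... | no t%q≢0 = begin-strict
    t                                                   ≡⟨ m≡m%n+[m/n]*n t q ⟩
    t % q + (t / q) * q                                 <⟨ +-mono-<-≤ (m<m*n (t % q) (q ^ suc k) {{≢-nonZero t%q≢0}} 1<q^[1+k])
                                                                       (*-monoˡ-≤ q (≤q^k*digitSum k (t / q) t/q<q^k)) ⟩
    t % q * q ^ suc k + q ^ k * digitSum (t / q) * q  ≡⟨ sym (q^[1+k]*digitSum k t) ⟩
    q ^ suc k * digitSum t                              ∎
    where
    open ≤-Reasoning
    t/q<q^k : t / q < q ^ k
    t/q<q^k = m<n*o⇒m/o<n (subst (t <_) (*-comm q (q ^ k)) t<q^[1+k])
    1<q^[1+k] : 1 < q ^ suc k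
    1<q^[1+k] = <-≤-trans 1<q (m≤m*n q (q ^ k) {{m^n≢0 q k}})
  ... | yes t%q≡0 = begin-strict
    t                                                   ≡⟨ m≡m%n+[m/n]*n t q ⟩
    t % q + (t / q) * q                                 <⟨ +-mono-≤-< (m≤m*n (t % q) (q ^ suc k) {{m^n≢0 q (suc k)}})
                                                                       (*-monoˡ-< q (<q^k*digitSum k (t / q) 0<t/q t/q<q^k)) ⟩
    t % q * q ^ suc k + q ^ k * digitSum (t / q) * q  ≡⟨ sym (q^[1+k]*digitSum k t) ⟩
    q ^ suc k * digitSum t                              ∎
    where
    open ≤-Reasoning
    t/q<q^k : t / q < q ^ k
    t/q<q^k = m<n*o⇒m/o<n (subst (t <_) (*-comm q (q ^ k)) t<q^[1+k])
    0<t/q : 0 < t / q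
    0<t/q with t / q ≟ 0
    ... | no t/q≢0 = n≢0⇒n>0 t/q≢0
    ... | yes t/q≡0 = contradiction (trans (m≡m%n+[m/n]*n t q) (cong₂ (λ a b → a + b * q) t%q≡0 t/q≡0)) (≢-nonZero⁻¹ t {{>-nonZero 0<t}})

  digitSum-< : ∀ {m} → m < q → digitSum m ≡ m
  digitSum-< {m} m<q = trans (cong digitSum (sym (+-identityʳ m))) (trans (digitSum-+* m 0 m<q) (trans (cong (λ z → m + z) digitSum[0]) (+-identityʳ m)))

  ν[m!]≡0 : ∀ {m} → m < q → ν (m !) ≡ 0
  ν[m!]≡0 {m} m<q = *-cancelˡ-≡ (ν (m !)) 0 q-1 (trans (+-cancelʳ-≡ m _ _ eq) (sym (*-zeroʳ q-1)))
    where
    eq : q-1 * ν (m !) + m ≡ 0 + m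
    eq = trans (cong (λ z → q-1 * ν (m !) + z) (sym (digitSum-< m<q))) (legendre m)

  ν[m!]≡1 : ∀ {m} → q ≤ m → m < q + q → ν (m !) ≡ 1
  ν[m!]≡1 {m} q≤m m<2q = *-cancelˡ-≡ (ν (m !)) 1 q-1 (+-cancelʳ-≡ (d + 1) _ _ eq)
    where
    d : ℕ
    d = m ∸ q
    digitSum[m] : digitSum m ≡ d + 1
    digitSum[m] = begin
      digitSum m          ≡⟨ cong digitSum (sym (trans (cong (λ z → d + z) (*-identityˡ q)) (m∸n+n≡m q≤m))) ⟩
      digitSum (d + 1 * q) ≡⟨ digitSum-+* d 1 (+-cancelʳ-< q d q (subst (_< q + q) (sym (m∸n+n≡m q≤m)) m<2q)) ⟩
      d + digitSum 1       ≡⟨ cong (λ z → d + z) (digitSum-< 1<q) ⟩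
      d + 1                ∎
      where open ≡-Reasoning
    ring : ∀ d p → d + suc p ≡ p * 1 + (d + 1)
    ring = solve-∀
    eq : q-1 * ν (m !) + (d + 1) ≡ q-1 * 1 + (d + 1)
    eq = trans (cong (λ z → q-1 * ν (m !) + z) (sym digitSum[m]))
           (trans (legendre m) (trans (sym (m∸n+n≡m q≤m)) (trans (cong (λ z → d + z) (sym suc[q-1]≡q)) (ring d q-1))))

  ν[C]≡0 : ∀ {n r} → q ≤ n → n + r < q + q → ν ((n + r) C n) ≡ 0
  ν[C]≡0 {n} {r} q≤n n+r<2q = +-cancelʳ-≡ 1 _ 0 (begin
    ν ((n + r) C n) + 1                   ≡⟨ cong (λ z → ν ((n + r) C n) + z) (sym (cong₂ _+_ (ν[m!]≡1 q≤n n<2q) (ν[m!]≡0 r<q))) ⟩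
    ν ((n + r) C n) + (ν (n !) + ν (r !))  ≡⟨ cong (λ z → ν ((n + r) C n) + z) (sym (ν-* (n !) (r !) {{n !≢0}} {{r !≢0}})) ⟩
    ν ((n + r) C n) + ν (n ! * r !)        ≡⟨ ν-factors ((n + r) C n) (n ! * r !) (C[x+y,x]*x!*y!≡[x+y]! n r) {{(n + r) !≢0}} ⟩
    ν ((n + r) !)                          ≡⟨ ν[m!]≡1 (≤-trans q≤n (m≤m+n n r)) n+r<2q ⟩
    1                                      ∎)
    where
    open ≡-Reasoning
    n<2q : n < q + q
    n<2q = ≤-<-trans (m≤m+n n r) n+r<2q
    r<q : r < q
    r<q = +-cancelˡ-< q r q (≤-<-trans (+-monoˡ-≤ r q≤n) n+r<2q)

  private
    no-carry⇒ν[C]≡0 : ∀ x y → digitSum x + digitSum y ≤ digitSum (x + y) → ν ((x + y) C x) ≡ 0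
    no-carry⇒ν[C]≡0 x y s≤ = *-cancelˡ-≡ _ 0 q-1 (trans (n≤0⇒n≡0 (+-cancelʳ-≤ (digitSum (x + y)) _ 0
      (subst (_≤ digitSum (x + y)) (sym (kummer x y)) s≤))) (sym (*-zeroʳ q-1)))

    ν[C]≡0⇒no-carry : ∀ x y → ν ((x + y) C x) ≡ 0 → digitSum (x + y) ≡ digitSum x + digitSum y
    ν[C]≡0⇒no-carry x y νC≡0 = trans (sym (cong (_+ digitSum (x + y)) (trans (cong (q-1 *_) νC≡0) (*-zeroʳ q-1)))) (kummer x y)

  ν[C]≡0-low : ∀ k {a N r} → a < q ^ k → ν ((a + N * q ^ k + r) C (a + N * q ^ k)) ≡ 0 → ν ((a + r) C a) ≡ 0
  ν[C]≡0-low k {a} {N} {r} a<q^k νC≡0 = no-carry⇒ν[C]≡0 a r (+-cancelʳ-≤ (digitSum N) _ _ (begin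
    (digitSum a + digitSum r) + digitSum N     ≡⟨ ring₁ (digitSum a) (digitSum r) (digitSum N) ⟩
    (digitSum a + digitSum N) + digitSum r     ≡⟨ cong (_+ digitSum r) (sym (digitSum-+*q^ k a N a<q^k)) ⟩
    digitSum (a + N * q ^ k) + digitSum r      ≡⟨ sym (ν[C]≡0⇒no-carry (a + N * q ^ k) r νC≡0) ⟩
    digitSum (a + N * q ^ k + r)               ≡⟨ cong digitSum (ring₂ a (N * q ^ k) r) ⟩
    digitSum ((a + r) + N * q ^ k)             ≤⟨ digitSum-+-≤ (a + r) (N * q ^ k) ⟩
    digitSum (a + r) + digitSum (N * q ^ k)    ≡⟨ cong (λ z → digitSum (a + r) + z) (digitSum-*q^ k N) ⟩
    digitSum (a + r) + digitSum N              ∎))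
    where
    open ≤-Reasoning
    ring₁ : ∀ a r N → (a + r) + N ≡ (a + N) + r
    ring₁ = solve-∀
    ring₂ : ∀ a b r → (a + b) + r ≡ (a + r) + b
    ring₂ = solve-∀

  private
    regroupₗ : ∀ Q M sN t → Q * sN + (t + M * Q) ≡ Q * (M + sN) + t
    regroupₗ = solve-∀
    regroupᵣ : ∀ Q N sM st → Q * (st + sM) + N * Q ≡ Q * (N + sM) + Q * st
    regroupᵣ = solve-∀

  digitSum-hull-≤ : ∀ k {t M N} → t < q ^ k → M ≤ N →
             q ^ k * digitSum N + (t + M * q ^ k) ≤ q ^ k * digitSum (t + M * q ^ k) + N * q ^ k
  digitSum-hull-≤ k {t} {M} {N} t<Q M≤N = subst₂ _≤_
    (sym (regroupₗ (q ^ k) M (digitSum N) t))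
    (trans (sym (regroupᵣ (q ^ k) N (digitSum M) (digitSum t))) (cong (λ s → q ^ k * s + N * q ^ k) (sym (digitSum-+*q^ k t M t<Q))))
    (+-mono-≤ (*-monoʳ-≤ (q ^ k) (m+s[n]≤n+s[m] M≤N)) (≤q^k*digitSum k t t<Q))

  digitSum-hull-< : ∀ k {t M N} → t < q ^ k → (0 < t × M ≤ N) ⊎ ν (M !) < ν (N !) →
             q ^ k * digitSum N + (t + M * q ^ k) < q ^ k * digitSum (t + M * q ^ k) + N * q ^ k
  digitSum-hull-< k {t} {M} {N} t<Q strictly = subst₂ _<_
    (sym (regroupₗ (q ^ k) M (digitSum N) t))
    (trans (sym (regroupᵣ (q ^ k) N (digitSum M) (digitSum t))) (cong (λ s → q ^ k * s + N * q ^ k) (sym (digitSum-+*q^ k t M t<Q))))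
    (strict strictly)
    where
    instance _ = m^n≢0 q k
    strict : (0 < t × M ≤ N) ⊎ ν (M !) < ν (N !) → q ^ k * (M + digitSum N) + t < q ^ k * (N + digitSum M) + q ^ k * digitSum t
    strict (inj₁ (0<t , M≤N)) = +-mono-≤-< (*-monoʳ-≤ (q ^ k) (m+s[n]≤n+s[m] M≤N)) (<q^k*digitSum k t 0<t t<Q)
    strict (inj₂ νM!<νN!) = +-mono-<-≤ (*-monoʳ-< (q ^ k) (m+s[n]<n+s[m] νM!<νN!)) (≤q^k*digitSum k t t<Q)

  digitSum-hull-≡ : ∀ k N → q ^ k * digitSum (N * q ^ k) + (N / q * q) * q ^ k ≡ q ^ k * digitSum ((N / q * q) * q ^ k) + N * q ^ k
  digitSum-hull-≡ k N = begin
    q ^ k * digitSum (N * q ^ k) + N′ * q ^ k                 ≡⟨ cong (λ s → q ^ k * s + N′ * q ^ k) (trans (digitSum-*q^ k N) (digitSum-unfold N)) ⟩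
    q ^ k * (N % q + digitSum (N / q)) + N′ * q ^ k           ≡⟨ ring (q ^ k) (N % q) (digitSum (N / q)) N′ ⟩
    q ^ k * digitSum (N / q) + (N % q + N′) * q ^ k           ≡⟨ cong₂ (λ s m → q ^ k * s + m * q ^ k) (sym digitSum[N′*q^k]) (sym (m≡m%n+[m/n]*n N q)) ⟩
    q ^ k * digitSum (N′ * q ^ k) + N * q ^ k                 ∎
    where
    open ≡-Reasoning
    N′ : ℕ
    N′ = N / q * q
    ring : ∀ Q a b c → Q * (a + b) + c * Q ≡ Q * b + (a + c) * Q
    ring = solve-∀
    digitSum[N′*q^k] : digitSum (N′ * q ^ k) ≡ digitSum (N / q)
    digitSum[N′*q^k] = trans (digitSum-*q^ k N′) (digitSum-+* 0 (N / q) (>-nonZero⁻¹ q))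

-- Newton polygons

data Side : Set where
  left right : Side

_⊏⟨_⟩_ : ℕ → Side → ℕ → Set
i ⊏⟨ left ⟩ j = i < j
i ⊏⟨ right ⟩ j = j < i

_⊏?⟨_⟩_ : ∀ i s j → Dec (i ⊏⟨ s ⟩ j)
i ⊏?⟨ left ⟩ j = i <? j
i ⊏?⟨ right ⟩ j = j <? i

⊏-irrefl : ∀ s {i} → ¬ i ⊏⟨ s ⟩ i
⊏-irrefl left = <-irrefl refl
⊏-irrefl right = <-irrefl refl

⊏-trans : ∀ s {i j k} → i ⊏⟨ s ⟩ j → j ⊏⟨ s ⟩ k → i ⊏⟨ s ⟩ k
⊏-trans left = <-trans
⊏-trans right i⊏j j⊏k = <-trans j⊏k i⊏j

⊏-tri : ∀ s i j → i ⊏⟨ s ⟩ j ⊎ i ≡ j ⊎ j ⊏⟨ s ⟩ i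
⊏-tri s i j with <-cmp i j | s
... | tri< i<j _ _ | left = inj₁ i<j
... | tri< i<j _ _ | right = inj₂ (inj₂ i<j)
... | tri≈ _ i≡j _ | _ = inj₂ (inj₁ i≡j)
... | tri> _ _ j<i | left = inj₂ (inj₂ j<i)
... | tri> _ _ j<i | right = inj₁ j<i

private
  <-split : ∀ {i j i₀ j₀} → i + j < i₀ + j₀ ⊎ (i + j ≡ i₀ + j₀ × i ≢ i₀) → i < i₀ ⊎ j < j₀
  <-split {i} {j} {i₀} {j₀} h with i <? i₀ | j <? j₀
  ... | yes i<i₀ | _ = inj₁ i<i₀
  ... | no _ | yes j<j₀ = inj₂ j<j₀
  ... | no i≮i₀ | no j≮j₀ with h
  ...   | inj₁ i+j<i₀+j₀ = contradiction (+-mono-≤ (≮⇒≥ i≮i₀) (≮⇒≥ j≮j₀)) (<⇒≱ i+j<i₀+j₀)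
  ...   | inj₂ (i+j≡i₀+j₀ , i≢i₀) with m≤n⇒m<n∨m≡n (≮⇒≥ i≮i₀)
  ...     | inj₂ i₀≡i = contradiction (sym i₀≡i) i≢i₀
  ...     | inj₁ i₀<i = contradiction (+-mono-<-≤ i₀<i (≮⇒≥ j≮j₀)) (<-irrefl (sym i+j≡i₀+j₀))

⊏-split : ∀ s {i j i₀ j₀} → (i + j) ⊏⟨ s ⟩ (i₀ + j₀) ⊎ (i + j ≡ i₀ + j₀ × i ≢ i₀) → i ⊏⟨ s ⟩ i₀ ⊎ j ⊏⟨ s ⟩ j₀
⊏-split left = <-split
⊏-split right (inj₁ lt) = <-split (inj₁ lt)
⊏-split right (inj₂ (eq , ne)) = <-split (inj₂ (sym eq , ne ∘ sym))

module Newton {q : ℕ} (q-prime : Prime q) where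
  open Valuation q-prime

  weight : (A B : ℕ) → (ℕ → ℚ) → ℕ → ℤ
  weight A B P i = + B ℤ.* νℚ (P i) ℤ.+ + (A * i)

  -- i is the leftmost (s = left) or rightmost (s = right) index of minimal weight among the
  -- nonzero coefficients of P: an end of the edge of slope −A/B of the q-adic Newton polygon.
  record IsEnd (s : Side) (A B : ℕ) (P : ℕ → ℚ) (i : ℕ) : Set where
    field
      nonzero : P i ≢ 0ℚ
      minimal : ∀ j → P j ≢ 0ℚ → weight A B P i ℤ.≤ weight A B P j
      strict  : ∀ j → j ⊏⟨ s ⟩ i → P j ≢ 0ℚ → weight A B P i ℤ.< weight A B P j

  IsEnd-cong : ∀ {s A B P P′ i} → (∀ j → P j ≡ P′ j) → IsEnd s A B P i → IsEnd s A B P′ i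
  IsEnd-cong {s} {A} {B} {P} {P′} {i} P≗P′ e = record
    { nonzero = λ P′i≡0 → nonzero (trans (P≗P′ i) P′i≡0)
    ; minimal = λ j P′j≢0 → subst₂ ℤ._≤_ (w≡ i) (w≡ j) (minimal j (P′j≢0 ∘ trans (sym (P≗P′ j))))
    ; strict = λ j j⊏i P′j≢0 → subst₂ ℤ._<_ (w≡ i) (w≡ j) (strict j j⊏i (P′j≢0 ∘ trans (sym (P≗P′ j))))
    }
    where
    open IsEnd e
    w≡ : ∀ j → weight A B P j ≡ weight A B P′ j
    w≡ j = cong (λ x → + B ℤ.* νℚ x ℤ.+ + (A * j)) (P≗P′ j)

  IsEnd-unique : ∀ {s A B P i i′} → IsEnd s A B P i → IsEnd s A B P i′ → i ≡ i′
  IsEnd-unique {s} {i = i} {i′} e e′ with ⊏-tri s i i′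
  ... | inj₁ i⊏i′ = contradiction (IsEnd.minimal e i′ (IsEnd.nonzero e′)) (ℤP.<⇒≱ (IsEnd.strict e′ i i⊏i′ (IsEnd.nonzero e)))
  ... | inj₂ (inj₁ i≡i′) = i≡i′
  ... | inj₂ (inj₂ i′⊏i) = contradiction (IsEnd.minimal e′ i (IsEnd.nonzero e)) (ℤP.<⇒≱ (IsEnd.strict e i′ i′⊏i (IsEnd.nonzero e′)))

  module _ {A B : ℕ} {s : Side} {g h : ℕ → ℚ} {i₀ j₀ : ℕ} (eg : IsEnd s A B g i₀) (eh : IsEnd s A B h j₀) where
    private
      W : ℤ
      W = weight A B g i₀ ℤ.+ weight A B h j₀
      K₀ : ℕ
      K₀ = i₀ + j₀
      term : ℕ → ℕ → ℚ
      term K i = g i ℚ.* h (K ∸ i)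
      shifted : ℕ → ℤ → ℤ
      shifted K v = + B ℤ.* v ℤ.+ + (A * K)

      term-weight : ∀ {K i} → i ≤ K → g i ≢ 0ℚ → h (K ∸ i) ≢ 0ℚ → shifted K (νℚ (term K i)) ≡ weight A B g i ℤ.+ weight A B h (K ∸ i)
      term-weight {K} {i} i≤K gi≢0 hj≢0 = begin
        + B ℤ.* νℚ (g i ℚ.* h (K ∸ i)) ℤ.+ + (A * K)
          ≡⟨ cong₂ (λ v k → + B ℤ.* v ℤ.+ + (A * k)) (νℚ-* (g i) (h (K ∸ i)) gi≢0 hj≢0) (sym (m+[n∸m]≡n i≤K)) ⟩
        + B ℤ.* (νℚ (g i) ℤ.+ νℚ (h (K ∸ i))) ℤ.+ + (A * (i + (K ∸ i)))
          ≡⟨ cong (λ z → + B ℤ.* (νℚ (g i) ℤ.+ νℚ (h (K ∸ i))) ℤ.+ z) (trans (cong +_ (*-distribˡ-+ A i (K ∸ i))) (ℤP.pos-+ (A * i) (A * (K ∸ i)))) ⟩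
        + B ℤ.* (νℚ (g i) ℤ.+ νℚ (h (K ∸ i))) ℤ.+ (+ (A * i) ℤ.+ + (A * (K ∸ i)))
          ≡⟨ ring (+ B) (νℚ (g i)) (νℚ (h (K ∸ i))) (+ (A * i)) (+ (A * (K ∸ i))) ⟩
        weight A B g i ℤ.+ weight A B h (K ∸ i) ∎
        where
        open ≡-Reasoning
        ring : ∀ b x y u w → b ℤ.* (x ℤ.+ y) ℤ.+ (u ℤ.+ w) ≡ (b ℤ.* x ℤ.+ u) ℤ.+ (b ℤ.* y ℤ.+ w)
        ring = ℤ-Ring.solve-∀

      K₀∸i₀≡j₀ : K₀ ∸ i₀ ≡ j₀
      K₀∸i₀≡j₀ = m+n∸m≡n i₀ j₀

      term-zero : ∀ K i → g i ≡ 0ℚ ⊎ h (K ∸ i) ≡ 0ℚ → term K i ≡ 0ℚ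
      term-zero K i (inj₁ gi≡0) = trans (cong (ℚ._* h (K ∸ i)) gi≡0) (ℚP.*-zeroˡ (h (K ∸ i)))
      term-zero K i (inj₂ hj≡0) = trans (cong (g i ℚ.*_) hj≡0) (ℚP.*-zeroʳ (g i))

      term≥ : ∀ K i → i ≤ K → term K i ≡ 0ℚ ⊎ W ℤ.≤ shifted K (νℚ (term K i))
      term≥ K i i≤K with g i ℚ.≟ 0ℚ | h (K ∸ i) ℚ.≟ 0ℚ
      ... | yes gi≡0 | _ = inj₁ (term-zero K i (inj₁ gi≡0))
      ... | no _ | yes hj≡0 = inj₁ (term-zero K i (inj₂ hj≡0))
      ... | no gi≢0 | no hj≢0 = inj₂ (subst (W ℤ.≤_) (sym (term-weight i≤K gi≢0 hj≢0))
                                        (ℤP.+-mono-≤ (IsEnd.minimal eg i gi≢0) (IsEnd.minimal eh (K ∸ i) hj≢0)))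

      term> : ∀ K i → i ≤ K → i ⊏⟨ s ⟩ i₀ ⊎ (K ∸ i) ⊏⟨ s ⟩ j₀ → term K i ≡ 0ℚ ⊎ W ℤ.< shifted K (νℚ (term K i))
      term> K i i≤K off-end with g i ℚ.≟ 0ℚ | h (K ∸ i) ℚ.≟ 0ℚ
      ... | yes gi≡0 | _ = inj₁ (term-zero K i (inj₁ gi≡0))
      ... | no _ | yes hj≡0 = inj₁ (term-zero K i (inj₂ hj≡0))
      ... | no gi≢0 | no hj≢0 = inj₂ (subst (W ℤ.<_) (sym (term-weight i≤K gi≢0 hj≢0)) (bound off-end))
        where
        bound : i ⊏⟨ s ⟩ i₀ ⊎ (K ∸ i) ⊏⟨ s ⟩ j₀ → W ℤ.< weight A B g i ℤ.+ weight A B h (K ∸ i)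
        bound (inj₁ i⊏i₀) = ℤP.+-mono-<-≤ (IsEnd.strict eg i i⊏i₀ gi≢0) (IsEnd.minimal eh (K ∸ i) hj≢0)
        bound (inj₂ j⊏j₀) = ℤP.+-mono-≤-< (IsEnd.minimal eg i gi≢0) (IsEnd.strict eh (K ∸ i) j⊏j₀ hj≢0)

      split : ∀ K i → i ≤ K → K ⊏⟨ s ⟩ K₀ ⊎ (K ≡ K₀ × i ≢ i₀) → i ⊏⟨ s ⟩ i₀ ⊎ (K ∸ i) ⊏⟨ s ⟩ j₀
      split K i i≤K = ⊏-split s ∘ Data.Sum.map (subst (_⊏⟨ s ⟩ K₀) (sym K≡)) (λ (eq , ne) → trans K≡ eq , ne)
        where
        K≡ : i + (K ∸ i) ≡ K
        K≡ = m+[n∸m]≡n i≤K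

      term[K₀,i₀]≢0 : term K₀ i₀ ≢ 0ℚ
      term[K₀,i₀]≢0 = *-≢0 (IsEnd.nonzero eg) (subst (λ j → h j ≢ 0ℚ) (sym K₀∸i₀≡j₀) (IsEnd.nonzero eh))

      shifted-term[K₀,i₀] : shifted K₀ (νℚ (term K₀ i₀)) ≡ W
      shifted-term[K₀,i₀] = trans (term-weight (m≤m+n i₀ j₀) (IsEnd.nonzero eg) (λ z → term[K₀,i₀]≢0 (term-zero K₀ i₀ (inj₂ z))))
                                  (cong (λ j → weight A B g i₀ ℤ.+ weight A B h j) K₀∸i₀≡j₀)

      dominant : (g ⋆ h) K₀ ≢ 0ℚ × νℚ ((g ⋆ h) K₀) ≡ νℚ (term K₀ i₀)
      dominant = ∑≤-dominant K₀ (term K₀) i₀ (m≤m+n i₀ j₀) term[K₀,i₀]≢0 others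
        where
        others : ∀ i → i ≤ K₀ → i ≢ i₀ → term K₀ i ≡ 0ℚ ⊎ νℚ (term K₀ i₀) ℤ.< νℚ (term K₀ i)
        others i i≤K₀ i≢i₀ with term> K₀ i i≤K₀ (split K₀ i i≤K₀ (inj₂ (refl , i≢i₀)))
        ... | inj₁ z = inj₁ z
        ... | inj₂ W< = inj₂ (ℤP.*-cancelˡ-<-nonNeg (+ B) (i+k<j+k⇒i<j (+ (A * K₀)) (subst (ℤ._< shifted K₀ (νℚ (term K₀ i))) (sym shifted-term[K₀,i₀]) W<)))

      weight[K₀] : weight A B (g ⋆ h) K₀ ≡ W
      weight[K₀] = trans (cong (shifted K₀) (proj₂ dominant)) shifted-term[K₀,i₀]

      ⋆-minimal : ∀ K → (g ⋆ h) K ≢ 0ℚ → weight A B (g ⋆ h) K₀ ℤ.≤ weight A B (g ⋆ h) K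
      ⋆-minimal K c≢0 with ∑≤-closed (λ v → W ℤ.≤ shifted K v) (λ W≤ v≤ → ℤP.≤-trans W≤ (ℤP.+-monoˡ-≤ _ (ℤP.*-monoˡ-≤-nonNeg (+ B) v≤)))
                                    K (term K) (term≥ K)
      ... | inj₁ c≡0 = contradiction c≡0 c≢0
      ... | inj₂ W≤ = subst (ℤ._≤ _) (sym weight[K₀]) W≤

      ⋆-strict : ∀ K → K ⊏⟨ s ⟩ K₀ → (g ⋆ h) K ≢ 0ℚ → weight A B (g ⋆ h) K₀ ℤ.< weight A B (g ⋆ h) K
      ⋆-strict K K⊏K₀ c≢0 with ∑≤-closed (λ v → W ℤ.< shifted K v) (λ W< v≤ → ℤP.<-≤-trans W< (ℤP.+-monoˡ-≤ _ (ℤP.*-monoˡ-≤-nonNeg (+ B) v≤)))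
                                    K (term K) (λ i i≤K → term> K i i≤K (split K i i≤K (inj₁ K⊏K₀)))
      ... | inj₁ c≡0 = contradiction c≡0 c≢0
      ... | inj₂ W< = subst (ℤ._< _) (sym weight[K₀]) W<

    IsEnd-⋆ : IsEnd s A B (g ⋆ h) (i₀ + j₀)
    IsEnd-⋆ = record { nonzero = proj₁ dominant ; minimal = ⋆-minimal ; strict = ⋆-strict }

  module _ {A B : ℕ} where
    private
      record EndBelow (s : Side) (P : ℕ → ℚ) (N : ℕ) : Set where
        field
          index : ℕ
          index<N : index < N
          nonzero : P index ≢ 0ℚ
          minimal : ∀ j → j < N → P j ≢ 0ℚ → weight A B P index ℤ.≤ weight A B P j
          strict : ∀ j → j < N → j ⊏⟨ s ⟩ index → P j ≢ 0ℚ → weight A B P index ℤ.< weight A B P j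

      take-new : ∀ {s P N} → P N ≢ 0ℚ →
                 (∀ j → j < N → P j ≢ 0ℚ → weight A B P N ℤ.≤ weight A B P j) →
                 (∀ j → j < N → j ⊏⟨ s ⟩ N → P j ≢ 0ℚ → weight A B P N ℤ.< weight A B P j) →
                 EndBelow s P (suc N)
      take-new {s} {P} {N} PN≢0 below-≤ below-< = record
        { index = N ; index<N = ≤-refl ; nonzero = PN≢0
        ; minimal = λ j j<1+N → [ below-≤ j , (λ { refl _ → ℤP.≤-refl }) ]′ (m<1+n⇒m<n∨m≡n j<1+N)
        ; strict = λ j j<1+N → [ below-< j , (λ { refl N⊏N _ → contradiction N⊏N (⊏-irrefl s) }) ]′ (m<1+n⇒m<n∨m≡n j<1+N)
        }

      keep-old : ∀ {s P N} (e : EndBelow s P N) →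
                 (P N ≢ 0ℚ → weight A B P (EndBelow.index e) ℤ.≤ weight A B P N) →
                 (N ⊏⟨ s ⟩ EndBelow.index e → P N ≢ 0ℚ → weight A B P (EndBelow.index e) ℤ.< weight A B P N) →
                 EndBelow s P (suc N)
      keep-old {s} {P} {N} e at-N-≤ at-N-< = record
        { index = index ; index<N = m≤n⇒m≤1+n index<N ; nonzero = nonzero
        ; minimal = λ j j<1+N → [ minimal j , (λ { refl → at-N-≤ }) ]′ (m<1+n⇒m<n∨m≡n j<1+N)
        ; strict = λ j j<1+N → [ strict j , (λ { refl → at-N-< }) ]′ (m<1+n⇒m<n∨m≡n j<1+N)
        }
        where open EndBelow e

      endBelow : ∀ s P N → EndBelow s P N ⊎ (∀ j → j < N → P j ≡ 0ℚ)
      endBelow s P zero = inj₂ (λ _ ())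
      endBelow s P (suc N) with endBelow s P N | P N ℚ.≟ 0ℚ
      ... | inj₂ none | yes PN≡0 = inj₂ (λ j j<1+N → [ none j , (λ { refl → PN≡0 }) ]′ (m<1+n⇒m<n∨m≡n j<1+N))
      ... | inj₂ none | no PN≢0 = inj₁ (take-new PN≢0 (λ j j<N Pj≢0 → contradiction (none j j<N) Pj≢0)
                                                      (λ j j<N _ Pj≢0 → contradiction (none j j<N) Pj≢0))
      ... | inj₁ e | yes PN≡0 = inj₁ (keep-old e (contradiction PN≡0) (λ _ → contradiction PN≡0))
      ... | inj₁ e | no PN≢0 with ℤP.<-cmp (weight A B P N) (weight A B P (EndBelow.index e))
      ...   | tri< wN<we _ _ = inj₁ (take-new PN≢0 (λ j j<N Pj≢0 → ℤP.<⇒≤ (ℤP.<-≤-trans wN<we (EndBelow.minimal e j j<N Pj≢0)))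
                                                  (λ j j<N _ Pj≢0 → ℤP.<-≤-trans wN<we (EndBelow.minimal e j j<N Pj≢0)))
      ...   | tri> _ _ we<wN = inj₁ (keep-old e (λ _ → ℤP.<⇒≤ we<wN) (λ _ _ → we<wN))
      ...   | tri≈ _ wN≡we _ with N ⊏?⟨ s ⟩ EndBelow.index e
      ...     | yes N⊏e = inj₁ (take-new PN≢0 (λ j j<N Pj≢0 → subst (ℤ._≤ _) (sym wN≡we) (EndBelow.minimal e j j<N Pj≢0))
                                             (λ j j<N j⊏N Pj≢0 → subst (ℤ._< _) (sym wN≡we) (EndBelow.strict e j j<N (⊏-trans s j⊏N N⊏e) Pj≢0)))
      ...     | no N⋢e = inj₁ (keep-old e (λ _ → ℤP.≤-reflexive (sym wN≡we)) (λ N⊏e → contradiction N⊏e N⋢e))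

    opaque
      end-exists : ∀ s P N → (∀ j → N ≤ j → P j ≡ 0ℚ) → (∃ λ j → P j ≢ 0ℚ) → ∃ (IsEnd s A B P)
      end-exists s P N vanishes (j , Pj≢0) with endBelow s P N
      ... | inj₂ none = contradiction (none j (below Pj≢0)) Pj≢0
        where
        below : ∀ {j} → P j ≢ 0ℚ → j < N
        below {j} Pj≢0 = ≰⇒> (Pj≢0 ∘ vanishes j)
      ... | inj₁ e = index , record
        { nonzero = nonzero
        ; minimal = λ j Pj≢0 → minimal j (below Pj≢0) Pj≢0
        ; strict = λ j j⊏i Pj≢0 → strict j (below Pj≢0) j⊏i Pj≢0
        }
        where
        open EndBelow e
        below : ∀ {j} → P j ≢ 0ℚ → j < N
        below {j} Pj≢0 = ≰⇒> (Pj≢0 ∘ vanishes j)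

  ends-weight : ∀ {s s′ A B P i i′} → IsEnd s A B P i → IsEnd s′ A B P i′ → weight A B P i ≡ weight A B P i′
  ends-weight e e′ = ℤP.≤-antisym (IsEnd.minimal e _ (IsEnd.nonzero e′)) (IsEnd.minimal e′ _ (IsEnd.nonzero e))

  left≤right : ∀ {A B P i i′} → IsEnd left A B P i → IsEnd right A B P i′ → i ≤ i′
  left≤right {i = i} {i′} e e′ with i ≤? i′
  ... | yes i≤i′ = i≤i′
  ... | no i≰i′ = contradiction (ends-weight e e′) (ℤP.<⇒≢ (IsEnd.strict e i′ (≰⇒> i≰i′) (IsEnd.nonzero e′)))

  edge-divisible : ∀ {A B P i i′} → IsEnd left A B P i → IsEnd right A B P i′ → B ∣ A * (i′ ∸ i)
  edge-divisible {A} {B} {P} {i} {i′} e e′ = divides ℤ.∣ νℚ (P i) ℤ.- νℚ (P i′) ∣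
    (trans (cong ℤ.∣_∣ A*d≡) (trans (ℤP.abs-* (+ B) (νℚ (P i) ℤ.- νℚ (P i′))) (*-comm B _)))
    where
    d : ℕ
    d = i′ ∸ i
    i′≡ : + (A * i′) ≡ + (A * i) ℤ.+ + (A * d)
    i′≡ = trans (cong (λ k → + (A * k)) (sym (m+[n∸m]≡n (left≤right e e′))))
                (trans (cong +_ (*-distribˡ-+ A i d)) (ℤP.pos-+ (A * i) (A * d)))
    ring₁ : ∀ b y u w → w ≡ (b ℤ.* y ℤ.+ (u ℤ.+ w)) ℤ.- (b ℤ.* y ℤ.+ u)
    ring₁ = ℤ-Ring.solve-∀
    ring₂ : ∀ b x y u → (b ℤ.* x ℤ.+ u) ℤ.- (b ℤ.* y ℤ.+ u) ≡ b ℤ.* (x ℤ.- y)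
    ring₂ = ℤ-Ring.solve-∀
    A*d≡ : + (A * d) ≡ + B ℤ.* (νℚ (P i) ℤ.- νℚ (P i′))
    A*d≡ = begin
      + (A * d)                                                        ≡⟨ ring₁ (+ B) (νℚ (P i′)) (+ (A * i)) (+ (A * d)) ⟩
      (+ B ℤ.* νℚ (P i′) ℤ.+ (+ (A * i) ℤ.+ + (A * d))) ℤ.- (+ B ℤ.* νℚ (P i′) ℤ.+ + (A * i))
                                                                       ≡⟨ cong (λ z → (+ B ℤ.* νℚ (P i′) ℤ.+ z) ℤ.- (+ B ℤ.* νℚ (P i′) ℤ.+ + (A * i))) (sym i′≡) ⟩
      weight A B P i′ ℤ.- (+ B ℤ.* νℚ (P i′) ℤ.+ + (A * i))            ≡⟨ cong (ℤ._- (+ B ℤ.* νℚ (P i′) ℤ.+ + (A * i))) (sym (ends-weight e e′)) ⟩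
      weight A B P i ℤ.- (+ B ℤ.* νℚ (P i′) ℤ.+ + (A * i))             ≡⟨ ring₂ (+ B) (νℚ (P i)) (νℚ (P i′)) (+ (A * i)) ⟩
      + B ℤ.* (νℚ (P i) ℤ.- νℚ (P i′))                                  ∎
      where open ≡-Reasoning

  right≤left : ∀ {A B A′ B′ P i i′} → A * B′ < A′ * B → IsEnd left A B P i → IsEnd right A′ B′ P i′ → i′ ≤ i
  right≤left {A} {B} {A′} {B′} {P} {i} {i′} steeper e e′ with i′ ≤? i
  ... | yes i′≤i = i′≤i
  ... | no i′≰i = contradiction steeper (≤⇒≯ (ℤP.drop‿+≤+ (subst₂ ℤ._≤_ (sym (ℤP.pos-* A′ B)) (sym (ℤP.pos-* A B′)) (ℤP.0≤i-j⇒j≤i 0≤ab′-a′b))))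
    where
    x x′ : ℤ
    x = νℚ (P i)
    x′ = νℚ (P i′)
    d : ℕ
    d = i′ ∸ i
    ring : ∀ a b a′ b′ x x′ i d →
           b′ ℤ.* ((b ℤ.* x′ ℤ.+ a ℤ.* (i ℤ.+ d)) ℤ.- (b ℤ.* x ℤ.+ a ℤ.* i)) ℤ.+
           b ℤ.* ((b′ ℤ.* x ℤ.+ a′ ℤ.* i) ℤ.- (b′ ℤ.* x′ ℤ.+ a′ ℤ.* (i ℤ.+ d)))
           ≡ (a ℤ.* b′ ℤ.- a′ ℤ.* b) ℤ.* d
    ring = ℤ-Ring.solve-∀
    +[A*k] : ∀ A k → + (A * k) ≡ + A ℤ.* + k
    +[A*k] A k = ℤP.pos-* A k
    i′≡ : + i′ ≡ + i ℤ.+ + d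
    i′≡ = trans (cong +_ (sym (m+[n∸m]≡n (<⇒≤ (≰⇒> i′≰i))))) (ℤP.pos-+ i d)
    gap₁ : + 0 ℤ.≤ (+ B ℤ.* x′ ℤ.+ + A ℤ.* (+ i ℤ.+ + d)) ℤ.- (+ B ℤ.* x ℤ.+ + A ℤ.* + i)
    gap₁ = ℤP.i≤j⇒0≤j-i (subst₂ ℤ._≤_ (cong (λ z → + B ℤ.* x ℤ.+ z) (+[A*k] A i))
                                       (cong (λ z → + B ℤ.* x′ ℤ.+ z) (trans (+[A*k] A i′) (cong (+ A ℤ.*_) i′≡)))
                                       (IsEnd.minimal e i′ (IsEnd.nonzero e′)))
    gap₂ : + 0 ℤ.≤ (+ B′ ℤ.* x ℤ.+ + A′ ℤ.* + i) ℤ.- (+ B′ ℤ.* x′ ℤ.+ + A′ ℤ.* (+ i ℤ.+ + d))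
    gap₂ = ℤP.i≤j⇒0≤j-i (subst₂ ℤ._≤_ (cong (λ z → + B′ ℤ.* x′ ℤ.+ z) (trans (+[A*k] A′ i′) (cong (+ A′ ℤ.*_) i′≡)))
                                       (cong (λ z → + B′ ℤ.* x ℤ.+ z) (+[A*k] A′ i))
                                       (IsEnd.minimal e′ i (IsEnd.nonzero e)))
    0≤ab′-a′b : + 0 ℤ.≤ + A ℤ.* + B′ ℤ.- + A′ ℤ.* + B
    0≤ab′-a′b = ℤP.*-cancelʳ-≤-pos (+ 0) _ (+ d) {{ℤ.positive (ℤ.+<+ (m<n⇒0<n∸m (≰⇒> i′≰i)))}}
      (subst₂ ℤ._≤_ (cong₂ ℤ._+_ (ℤP.*-zeroʳ (+ B′)) (ℤP.*-zeroʳ (+ B))) (ring (+ A) (+ B) (+ A′) (+ B′) x x′ (+ i) (+ d))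
        (ℤP.+-mono-≤ (ℤP.*-monoˡ-≤-nonNeg (+ B′) gap₁) (ℤP.*-monoˡ-≤-nonNeg (+ B) gap₂)))

  -- For A = B = 0 all weights vanish, so right ends are degrees and IsEnd-⋆ gives additivity of degrees.
  module _ {P : ℕ → ℚ} {d : ℕ} where
    degree⇒right-end : IsDegree P d → IsEnd right 0 0 P d
    degree⇒right-end (Pd≢0 , above) = record
      { nonzero = Pd≢0 ; minimal = λ _ _ → ℤP.≤-refl ; strict = λ j d<j Pj≢0 → contradiction (above j d<j) Pj≢0 }

    right-end⇒degree : IsEnd right 0 0 P d → IsDegree P d
    right-end⇒degree e = IsEnd.nonzero e , λ j d<j → decidable-stable (P j ℚ.≟ 0ℚ) (λ Pj≢0 → ℤP.<-irrefl refl (IsEnd.strict e j d<j Pj≢0))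

  IsDegree-⋆ : ∀ {g h d e} → IsDegree g d → IsDegree h e → IsDegree (g ⋆ h) (d + e)
  IsDegree-⋆ deg-g deg-h = right-end⇒degree (IsEnd-⋆ (degree⇒right-end deg-g) (degree⇒right-end deg-h))

  degree-exists : ∀ P N → (∀ j → N ≤ j → P j ≡ 0ℚ) → (∃ λ j → P j ≢ 0ℚ) → ∃ (IsDegree P)
  degree-exists P N vanishes nonzero with end-exists right P N vanishes nonzero
  ... | d , e = d , right-end⇒degree e

  private
    ⋆-vanishing : ∀ {G H} → (∀ j → G j ≡ 0ℚ) ⊎ (∀ j → H j ≡ 0ℚ) → ∀ K → (G ⋆ H) K ≡ 0ℚ
    ⋆-vanishing {G} {H} (inj₁ G≡0) K = ∑≤-zero K _ (λ i → trans (cong (ℚ._* H (K ∸ i)) (G≡0 i)) (ℚP.*-zeroˡ (H (K ∸ i))))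
    ⋆-vanishing {G} {H} (inj₂ H≡0) K = ∑≤-zero K _ (λ i → trans (cong (G i ℚ.*_) (H≡0 (K ∸ i))) (ℚP.*-zeroʳ (G i)))

  factor-degrees : ∀ {P G H d} NG NH → (∀ j → P j ≡ (G ⋆ H) j) → IsDegree P d →
                   (∀ j → NG ≤ j → G j ≡ 0ℚ) → (∀ j → NH ≤ j → H j ≡ 0ℚ) → ∃ (IsDegree G) × ∃ (IsDegree H)
  factor-degrees {P} {G} {H} {d} NG NH P≗G⋆H (Pd≢0 , _) G-vanishes H-vanishes =
    degree-of G NG G-vanishes inj₁ , degree-of H NH H-vanishes inj₂
    where
    degree-of : ∀ X N → (∀ j → N ≤ j → X j ≡ 0ℚ) →
                ((∀ j → X j ≡ 0ℚ) → (∀ j → G j ≡ 0ℚ) ⊎ (∀ j → H j ≡ 0ℚ)) → ∃ (IsDegree X)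
    degree-of X N X-vanishes factor-of-zero with nonzero-or-vanishing X N
    ... | inj₁ nonzero = degree-exists X N X-vanishes nonzero
    ... | inj₂ vanishing = contradiction (trans (P≗G⋆H d) (⋆-vanishing (factor-of-zero X≡0) d)) Pd≢0
      where
      X≡0 : ∀ j → X j ≡ 0ℚ
      X≡0 j = [ X-vanishes j , vanishing j ]′ (≤-<-connex N j)

  ends-of-factors : ∀ {s A B P G H i i′ J} → (∀ j → P j ≡ (G ⋆ H) j) →
                    IsEnd s A B G i → IsEnd s A B H i′ → IsEnd s A B P J → i + i′ ≡ J
  ends-of-factors P≗G⋆H eG eH eP = IsEnd-unique (IsEnd-cong (sym ∘ P≗G⋆H) (IsEnd-⋆ eG eH)) eP

  end-exists-of-degree : ∀ s A B {P d} → IsDegree P d → ∃ (IsEnd s A B P)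
  end-exists-of-degree s A B {P} {d} (Pd≢0 , above) = end-exists s P (suc d) above (d , Pd≢0)

private
  coeff-map-applyUpTo : ∀ (F : ℕ → ℚ) (G : ℕ → ℕ) {m j} → j < m → coeff (map F (applyUpTo G m)) j ≡ F (G j)
  coeff-map-applyUpTo F G {suc m} {zero} _ = refl
  coeff-map-applyUpTo F G {suc m} {suc j} (s≤s j<m) = coeff-map-applyUpTo F (G ∘ suc) j<m

  coeff-map-applyUpTo-≥ : ∀ (F : ℕ → ℚ) (G : ℕ → ℕ) {m j} → m ≤ j → coeff (map F (applyUpTo G m)) j ≡ 0ℚ
  coeff-map-applyUpTo-≥ F G {zero} _ = refl
  coeff-map-applyUpTo-≥ F G {suc m} {suc j} (s≤s m≤j) = coeff-map-applyUpTo-≥ F (G ∘ suc) m≤j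

coeff-L : ∀ n r {j} → j ≤ n → coeff (L n r) j ≡ Lcoeff n r j
coeff-L n r j≤n = coeff-map-applyUpTo (Lcoeff n r) (λ j → j) (s≤s j≤n)

coeff-L-> : ∀ n r {j} → n < j → coeff (L n r) j ≡ 0ℚ
coeff-L-> n r n<j = coeff-map-applyUpTo-≥ (Lcoeff n r) (λ j → j) n<j

nonZero-C : ∀ x y → NonZero ((x + y) C x)
nonZero-C x y = m*n≢0⇒m≢0 ((x + y) C x) {{subst NonZero (sym (C[x+y,x]*x!*y!≡[x+y]! x y)) ((x + y) !≢0)}}

Lcoeff≢0 : ∀ n r j → Lcoeff n r j ≢ 0ℚ
Lcoeff≢0 n r j Lcoeff≡0 = ≢-nonZero⁻¹ _ {{nonZero-C (n ∸ j) r}} (ℤP.+-injective (/≡0⇒≡0 _ (j !) {{j !≢0}} Lcoeff≡0))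

IsDegree-L : ∀ n r → IsDegree (coeff (L n r)) n
IsDegree-L n r = (λ c≡0 → Lcoeff≢0 n r n (trans (sym (coeff-L n r ≤-refl)) c≡0)) , λ j → coeff-L-> n r

module CoefficientsOfL {q : ℕ} (q-prime : Prime q) where
  open Valuation q-prime
  open Newton q-prime

  νℚ-coeff-L : ∀ n r {j} → j ≤ n → νℚ (coeff (L n r) j) ≡ + ν ((n ∸ j + r) C (n ∸ j)) ℤ.- + ν (j !)
  νℚ-coeff-L n r {j} j≤n = trans (cong νℚ (coeff-L n r j≤n)) (νℚ-/ (+ ((n ∸ j + r) C (n ∸ j))) (j !) {{j !≢0}} {{nonZero-C (n ∸ j) r}})

  degrees-of-factors : ∀ {n r G H dG dH} → (∀ j → coeff (L n r) j ≡ (G ⋆ H) j) → IsDegree G dG → IsDegree H dH → dG + dH ≡ n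
  degrees-of-factors {n} {r} c≗G⋆H degG degH = IsDegree-unique (IsDegree-cong (sym ∘ c≗G⋆H) (IsDegree-⋆ degG degH)) (IsDegree-L n r)

-- A prime p with n + r < 2p and p ≤ n

module LargePrime {p : ℕ} (p-prime : Prime p) {n r : ℕ} (n+r<2p : n + r < 2 * p) (p≤n : p ≤ n) where
  open Valuation p-prime
  open DigitSum p-prime
  open Newton p-prime
  open CoefficientsOfL p-prime

  private
    c : ℕ → ℚ
    c = coeff (L n r)

    binom : ℕ → ℕ
    binom j = (n ∸ j + r) C (n ∸ j)

    n+r<p+p : n + r < p + p
    n+r<p+p = subst (n + r <_) (cong (λ z → p + z) (+-identityʳ p)) n+r<2p

    c≢0⇒≤n : ∀ {j} → c j ≢ 0ℚ → j ≤ n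
    c≢0⇒≤n {j} cj≢0 = ≮⇒≥ (cj≢0 ∘ coeff-L-> n r)

    ν[j!]≡1 : ∀ {j} → p ≤ j → j ≤ n → ν (j !) ≡ 1
    ν[j!]≡1 p≤j j≤n = ν[m!]≡1 p≤j (≤-<-trans j≤n (≤-<-trans (m≤m+n n r) n+r<p+p))

    0≤νc : ∀ {j} → j < p → + 0 ℤ.≤ νℚ (c j)
    0≤νc {j} j<p = subst (+ 0 ℤ.≤_) (sym (trans (νℚ-coeff-L n r j≤n) (trans (cong (λ x → + ν (binom j) ℤ.- + x) (ν[m!]≡0 j<p)) (ℤP.+-identityʳ (+ ν (binom j))))))
                         (ℤ.+≤+ z≤n)
      where
      j≤n : j ≤ n
      j≤n = <⇒≤ (<-≤-trans j<p p≤n)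

    -1≤νc : ∀ {j} → c j ≢ 0ℚ → -[1+ 0 ] ℤ.≤ νℚ (c j)
    -1≤νc {j} cj≢0 = [ from-p≤j , (λ j<p → ℤP.≤-trans ℤ.-≤+ (0≤νc j<p)) ]′ (≤-<-connex p j)
      where
      j≤n : j ≤ n
      j≤n = c≢0⇒≤n cj≢0
      from-p≤j : p ≤ j → -[1+ 0 ] ℤ.≤ νℚ (c j)
      from-p≤j p≤j = subst (-[1+ 0 ] ℤ.≤_) (sym (trans (νℚ-coeff-L n r j≤n) (cong (λ x → + ν (binom j) ℤ.- + x) (ν[j!]≡1 p≤j j≤n))))
                           (ℤP.+-monoˡ-≤ (ℤ.- + 1) (ℤ.+≤+ (z≤n {ν (binom j)})))

    νc[0]≡0 : νℚ (c 0) ≡ + 0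
    νc[0]≡0 = trans (νℚ-coeff-L n r z≤n) (cong₂ (λ a b → + a ℤ.- + b) (ν[C]≡0 p≤n n+r<p+p) ν[1])

    νc[n]≡-1 : νℚ (c n) ≡ -[1+ 0 ]
    νc[n]≡-1 = trans (νℚ-coeff-L n r ≤-refl)
                 (cong₂ (λ a b → + a ℤ.- + b) (trans (cong (λ m → ν ((m + r) C m)) (n∸n≡0 n)) ν[1]) (ν[j!]≡1 p≤n ≤-refl))

    -- For the weight ν itself this is the first index where ν (c j) reaches its minimum −1.
    first-negative : ∃ (IsEnd left 0 1 c)
    first-negative = end-exists-of-degree left 0 1 (IsDegree-L n r)

    k : ℕ
    k = proj₁ first-negative

    weight[0,1] : ∀ j → weight 0 1 c j ≡ νℚ (c j)
    weight[0,1] j = trans (ℤP.+-identityʳ _) (ℤP.*-identityˡ _)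

    νc[k]≡-1 : νℚ (c k) ≡ -[1+ 0 ]
    νc[k]≡-1 = ℤP.≤-antisym
      (subst₂ ℤ._≤_ (weight[0,1] k) (trans (weight[0,1] n) νc[n]≡-1) (IsEnd.minimal (proj₂ first-negative) n (proj₁ (IsDegree-L n r))))
      (-1≤νc {k} (IsEnd.nonzero (proj₂ first-negative)))

    0≤νc-below-k : ∀ {j} → j < k → c j ≢ 0ℚ → + 0 ℤ.≤ νℚ (c j)
    0≤νc-below-k {j} j<k cj≢0 = ℤP.i<j⇒suc[i]≤j (subst₂ ℤ._<_ (trans (weight[0,1] k) νc[k]≡-1) (weight[0,1] j)
                                                  (IsEnd.strict (proj₂ first-negative) j j<k cj≢0))

    p≤k : p ≤ k
    p≤k = ≮⇒≥ (λ k<p → ℤP.<⇒≱ (subst (ℤ._< + 0) (sym νc[k]≡-1) ℤ.-<+) (0≤νc k<p))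

    weight[1,k] : ∀ j → weight 1 k c j ≡ + k ℤ.* νℚ (c j) ℤ.+ + j
    weight[1,k] j = cong (λ z → + k ℤ.* νℚ (c j) ℤ.+ + z) (*-identityˡ j)

    weight[1,k]≥ : ∀ {j} → c j ≢ 0ℚ → + (j ∸ k) ℤ.≤ weight 1 k c j
    weight[1,k]≥ {j} cj≢0 = [ from-k≤j , from-j<k ]′ (≤-<-connex k j)
      where
      from-j<k : j < k → + (j ∸ k) ℤ.≤ weight 1 k c j
      from-j<k j<k = subst₂ ℤ._≤_ (cong +_ (sym (m≤n⇒m∸n≡0 (<⇒≤ j<k)))) (sym (weight[1,k] j))
        (ℤP.+-mono-≤ (subst (ℤ._≤ + k ℤ.* νℚ (c j)) (ℤP.*-zeroʳ (+ k)) (ℤP.*-monoˡ-≤-nonNeg (+ k) (0≤νc-below-k j<k cj≢0))) (ℤ.+≤+ z≤n))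
      from-k≤j : k ≤ j → + (j ∸ k) ℤ.≤ weight 1 k c j
      from-k≤j k≤j = subst₂ ℤ._≤_ (trans (ℤP.-m+n≡n⊖m k j) (ℤP.⊖-≥ k≤j)) (sym (weight[1,k] j))
        (ℤP.+-monoˡ-≤ (+ j) (subst (ℤ._≤ + k ℤ.* νℚ (c j)) (trans (ℤP.*-comm (+ k) -[1+ 0 ]) (ℤP.-1*i≡-i (+ k)))
                                   (ℤP.*-monoˡ-≤-nonNeg (+ k) (-1≤νc {j} cj≢0))))

    weight[1,k]-at-0 : weight 1 k c 0 ≡ + 0
    weight[1,k]-at-0 = trans (weight[1,k] 0) (trans (ℤP.+-identityʳ _) (trans (cong (+ k ℤ.*_) νc[0]≡0) (ℤP.*-zeroʳ (+ k))))

    weight[1,k]-at-k : weight 1 k c k ≡ + 0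
    weight[1,k]-at-k = trans (weight[1,k] k) (trans (cong (λ z → + k ℤ.* z ℤ.+ + k) νc[k]≡-1)
                         (trans (cong (ℤ._+ + k) (trans (ℤP.*-comm (+ k) -[1+ 0 ]) (ℤP.-1*i≡-i (+ k)))) (ℤP.+-inverseˡ (+ k))))

    c-left-end : IsEnd left 1 k c 0
    c-left-end = record
      { nonzero = λ c0≡0 → Lcoeff≢0 n r 0 (trans (sym (coeff-L n r z≤n)) c0≡0)
      ; minimal = λ j cj≢0 → subst (ℤ._≤ weight 1 k c j) (sym weight[1,k]-at-0) (ℤP.≤-trans (ℤ.+≤+ (z≤n {j ∸ k})) (weight[1,k]≥ cj≢0))
      ; strict = λ _ ()
      }

    c-right-end : IsEnd right 1 k c k
    c-right-end = record
      { nonzero = IsEnd.nonzero (proj₂ first-negative)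
      ; minimal = λ j cj≢0 → subst (ℤ._≤ weight 1 k c j) (sym weight[1,k]-at-k) (ℤP.≤-trans (ℤ.+≤+ (z≤n {j ∸ k})) (weight[1,k]≥ cj≢0))
      ; strict = λ j k<j cj≢0 → subst (ℤ._< weight 1 k c j) (sym weight[1,k]-at-k) (ℤP.<-≤-trans (ℤ.+<+ (m<n⇒0<n∸m k<j)) (weight[1,k]≥ cj≢0))
      }

  large-factor : ∀ {G H dG dH} → (∀ j → c j ≡ (G ⋆ H) j) → IsDegree G dG → IsDegree H dH → p ≤ dG ⊎ p ≤ dH
  large-factor {G} {H} {dG} {dH} c≗G⋆H degG degH = from-ends (proj₂ (end-exists-of-degree left 1 k degG)) (proj₂ (end-exists-of-degree left 1 k degH))
                                                          (proj₂ (end-exists-of-degree right 1 k degG)) (proj₂ (end-exists-of-degree right 1 k degH))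
    where
    from-ends : ∀ {mG mH MG MH} → IsEnd left 1 k G mG → IsEnd left 1 k H mH → IsEnd right 1 k G MG → IsEnd right 1 k H MH → p ≤ dG ⊎ p ≤ dH
    from-ends {mG} {mH} {MG} {MH} eGₗ eHₗ eGᵣ eHᵣ = by-cases (MH ≟ 0)
      where
      MH≡0⇒ : MH ≡ 0 → p ≤ dG ⊎ p ≤ dH
      MH≡0⇒ MH≡0 = inj₁ (≤-trans p≤k (≤-trans (≤-reflexive (sym MG≡k)) (≤-degree degG (IsEnd.nonzero eGᵣ))))
        where
        MG≡k : MG ≡ k
        MG≡k = trans (sym (+-identityʳ MG)) (trans (cong (λ x → MG + x) (sym MH≡0)) (ends-of-factors c≗G⋆H eGᵣ eHᵣ c-right-end))
      MH≢0⇒ : MH ≢ 0 → p ≤ dG ⊎ p ≤ dH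
      MH≢0⇒ MH≢0 = inj₂ (≤-trans p≤k (≤-trans (∣⇒≤ {{≢-nonZero MH≢0}} k∣MH) (≤-degree degH (IsEnd.nonzero eHᵣ))))
        where
        mH≡0 : mH ≡ 0
        mH≡0 = m+n≡0⇒n≡0 mG (ends-of-factors c≗G⋆H eGₗ eHₗ c-left-end)
        k∣MH : k ∣ MH
        k∣MH = subst (k ∣_) (trans (cong (λ x → 1 * (MH ∸ x)) mH≡0) (*-identityˡ MH)) (edge-divisible eHₗ eHᵣ)
      by-cases : Dec (MH ≡ 0) → p ≤ dG ⊎ p ≤ dH
      by-cases (yes MH≡0) = MH≡0⇒ MH≡0
      by-cases (no MH≢0) = MH≢0⇒ MH≢0

-- Primes q with q ∤ C(n+r, r)

private
  squeeze : ∀ {a b c d} → a + b ≡ c + d → c ≤ a → d ≤ b → a ≡ c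
  squeeze {a} {b} {c} {d} eq c≤a d≤b with m≤n⇒m<n∨m≡n c≤a
  ... | inj₂ c≡a = sym c≡a
  ... | inj₁ c<a = contradiction (sym eq) (<⇒≢ (+-mono-<-≤ c<a d≤b))

  ∣-telescope : ∀ {D} (M m : ℕ → ℕ) → (∀ t → m t ≤ M t) → (∀ t → m t ≡ M (suc t)) → (∀ t → D ∣ M t ∸ m t) →
                ∀ K → D ∣ M K → D ∣ M 0
  ∣-telescope M m m≤M chained D∣gap zero D∣M = D∣M
  ∣-telescope {D} M m m≤M chained D∣gap (suc K) D∣M[1+K] =
    ∣-telescope M m m≤M chained D∣gap K (∣m∸n∣n⇒∣m D (m≤M K) (D∣gap K) (subst (D ∣_) (sym (chained K)) D∣M[1+K]))

module CoprimePrime {q : ℕ} (q-prime : Prime q) {n r : ℕ} (q∤C : ¬ q ∣ (n + r) C r) where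
  open Valuation q-prime
  open DigitSum q-prime
  open Newton q-prime
  open CoefficientsOfL q-prime

  private
    c : ℕ → ℚ
    c = coeff (L n r)

    binom : ℕ → ℕ
    binom j = (n ∸ j + r) C (n ∸ j)

  slopeA slopeB : ℕ → ℕ
  slopeA k = q ^ k ∸ 1
  slopeB k = q-1 * q ^ k

  vertex : ℕ → ℕ
  vertex k = (n / q ^ k) {{m^n≢0 q k}} * q ^ k

  module _ (k : ℕ) where
    private instance
      q^k≢0 : NonZero (q ^ k)
      q^k≢0 = m^n≢0 q k

    vertex≤n : vertex k ≤ n
    vertex≤n = m/n*n≤m n (q ^ k)

    -- n ∸ vertex k = n % q ^ k, and truncating n to its last k digits keeps n + r carry-free.
    ν[binom[vertex]]≡0 : ν (binom (vertex k)) ≡ 0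
    ν[binom[vertex]]≡0 = subst (λ a → ν ((a + r) C a) ≡ 0) (sym n∸vertex≡) (ν[C]≡0-low k {N = n / q ^ k} (m%n<n n (q ^ k)) νC≡0)
      where
      n≡ : n ≡ n % q ^ k + (n / q ^ k) * q ^ k
      n≡ = m≡m%n+[m/n]*n n (q ^ k)
      n∸vertex≡ : n ∸ vertex k ≡ n % q ^ k
      n∸vertex≡ = trans (cong (_∸ vertex k) n≡) (m+n∸n≡m (n % q ^ k) (vertex k))
      C-sym : (n + r) C r ≡ (n + r) C n
      C-sym = trans (nCk≡nC[n∸k] (m≤n+m r n)) (cong ((n + r) C_) (m+n∸n≡m n r))
      νC≡0 : ν ((n % q ^ k + (n / q ^ k) * q ^ k + r) C (n % q ^ k + (n / q ^ k) * q ^ k)) ≡ 0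
      νC≡0 = subst (λ m → ν ((m + r) C m) ≡ 0) n≡ (trans (cong ν (sym C-sym)) (ν≡0 q∤C))

    vertex-of-divisor : q ^ k ∣ n → vertex k ≡ n
    vertex-of-divisor = m/n*n≡m

    vertex-beyond : n < q ^ k → vertex k ≡ 0
    vertex-beyond n<q^k = cong (_* q ^ k) (m<n⇒m/n≡0 n<q^k)

    vertex-suc : vertex (suc k) ≡ ((n / q ^ k) / q * q) * q ^ k
    vertex-suc = begin
      (n / (q * q ^ k)) * (q * q ^ k)              ≡⟨ cong (_* (q * q ^ k)) (/-congʳ {m = n} (*-comm q (q ^ k))) ⟩
      (n / (q ^ k * q)) * (q * q ^ k)              ≡⟨ cong (_* (q * q ^ k)) (sym (m/n/o≡m/[n*o] n (q ^ k) q)) ⟩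
      (n / q ^ k / q) * (q * q ^ k)                ≡⟨ sym (*-assoc (n / q ^ k / q) q (q ^ k)) ⟩
      ((n / q ^ k) / q * q) * q ^ k                ∎
      where
      open ≡-Reasoning
      instance
        _ = m^n≢0 q (suc k)
        _ = m*n≢0 (q ^ k) q

  private
    height-identity : ∀ A P X S v →
      + (P * suc A) ℤ.* (+ v ℤ.- + X) ℤ.+ + (A * (P * X + S)) ≡ + (suc A * S + P * suc A * v) ℤ.- + (P * X + S)
    height-identity A P X S v = begin
      + (P * suc A) ℤ.* (+ v ℤ.- + X) ℤ.+ + (A * (P * X + S))
        ≡⟨ cong₂ (λ b w → b ℤ.* (+ v ℤ.- + X) ℤ.+ w) B≡ (trans (ℤP.pos-* A (P * X + S)) (cong (+ A ℤ.*_) j≡)) ⟩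
      (+ P ℤ.* (+ 1 ℤ.+ + A)) ℤ.* (+ v ℤ.- + X) ℤ.+ + A ℤ.* (+ P ℤ.* + X ℤ.+ + S)
        ≡⟨ ring (+ A) (+ P) (+ X) (+ S) (+ v) ⟩
      ((+ 1 ℤ.+ + A) ℤ.* + S ℤ.+ (+ P ℤ.* (+ 1 ℤ.+ + A)) ℤ.* + v) ℤ.- (+ P ℤ.* + X ℤ.+ + S)
        ≡⟨ cong₂ ℤ._-_ (sym E≡) (sym j≡) ⟩
      + (suc A * S + P * suc A * v) ℤ.- + (P * X + S) ∎
      where
      open ≡-Reasoning
      ring : ∀ a p x s v → (p ℤ.* (ℤ.+ 1 ℤ.+ a)) ℤ.* (v ℤ.- x) ℤ.+ a ℤ.* (p ℤ.* x ℤ.+ s)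
                           ≡ ((ℤ.+ 1 ℤ.+ a) ℤ.* s ℤ.+ (p ℤ.* (ℤ.+ 1 ℤ.+ a)) ℤ.* v) ℤ.- (p ℤ.* x ℤ.+ s)
      ring = ℤ-Ring.solve-∀
      sucA≡ : + suc A ≡ + 1 ℤ.+ + A
      sucA≡ = ℤP.pos-+ 1 A
      B≡ : + (P * suc A) ≡ + P ℤ.* (+ 1 ℤ.+ + A)
      B≡ = trans (ℤP.pos-* P (suc A)) (cong (+ P ℤ.*_) sucA≡)
      j≡ : + (P * X + S) ≡ + P ℤ.* + X ℤ.+ + S
      j≡ = trans (ℤP.pos-+ (P * X) S) (cong (ℤ._+ + S) (ℤP.pos-* P X))
      E≡ : + (suc A * S + P * suc A * v) ≡ (+ 1 ℤ.+ + A) ℤ.* + S ℤ.+ (+ P ℤ.* (+ 1 ℤ.+ + A)) ℤ.* + v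
      E≡ = trans (ℤP.pos-+ (suc A * S) (P * suc A * v))
             (cong₂ ℤ._+_ (trans (ℤP.pos-* (suc A) S) (cong (ℤ._* + S) sucA≡)) (trans (ℤP.pos-* (P * suc A) v) (cong (ℤ._* + v) B≡)))

  height : ℕ → ℕ → ℕ
  height k j = q ^ k * digitSum j + slopeB k * ν (binom j)

  weight≡height : ∀ k {j} → j ≤ n → weight (slopeA k) (slopeB k) c j ≡ + height k j ℤ.- + j
  weight≡height k {j} j≤n = begin
    + slopeB k ℤ.* νℚ (c j) ℤ.+ + (slopeA k * j)
      ≡⟨ cong₂ (λ v i → + slopeB k ℤ.* v ℤ.+ + (slopeA k * i)) (νℚ-coeff-L n r j≤n) (sym (legendre j)) ⟩
    + slopeB k ℤ.* (+ ν (binom j) ℤ.- + ν (j !)) ℤ.+ + (slopeA k * (q-1 * ν (j !) + digitSum j))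
      ≡⟨ cong (λ Q → + (q-1 * Q) ℤ.* (+ ν (binom j) ℤ.- + ν (j !)) ℤ.+ + (slopeA k * (q-1 * ν (j !) + digitSum j))) (sym suc[A]≡q^k) ⟩
    + (q-1 * suc (slopeA k)) ℤ.* (+ ν (binom j) ℤ.- + ν (j !)) ℤ.+ + (slopeA k * (q-1 * ν (j !) + digitSum j))
      ≡⟨ height-identity (slopeA k) q-1 (ν (j !)) (digitSum j) (ν (binom j)) ⟩
    + (suc (slopeA k) * digitSum j + q-1 * suc (slopeA k) * ν (binom j)) ℤ.- + (q-1 * ν (j !) + digitSum j)
      ≡⟨ cong₂ (λ Q i → + (Q * digitSum j + q-1 * Q * ν (binom j)) ℤ.- + i) suc[A]≡q^k (legendre j) ⟩
    + height k j ℤ.- + j ∎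
    where
    open ≡-Reasoning
    suc[A]≡q^k : suc (slopeA k) ≡ q ^ k
    suc[A]≡q^k = m+[n∸m]≡n (m^n>0 q k)

  private
    height[vertex] : ∀ k k′ → height k (vertex k′) ≡ q ^ k * digitSum (vertex k′)
    height[vertex] k k′ = trans (cong (λ v → q ^ k * digitSum (vertex k′) + slopeB k * v) (ν[binom[vertex]]≡0 k′))
                                (trans (cong (λ z → q ^ k * digitSum (vertex k′) + z) (*-zeroʳ (slopeB k))) (+-identityʳ _))

    c≢0⇒≤n : ∀ {j} → c j ≢ 0ℚ → j ≤ n
    c≢0⇒≤n {j} cj≢0 = ≮⇒≥ (cj≢0 ∘ coeff-L-> n r)

    c[vertex]≢0 : ∀ k → c (vertex k) ≢ 0ℚ
    c[vertex]≢0 k c≡0 = Lcoeff≢0 n r (vertex k) (trans (sym (coeff-L n r (vertex≤n k))) c≡0)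

  module _ (k : ℕ) where
    private
      instance
        q^k≢0 : NonZero (q ^ k)
        q^k≢0 = m^n≢0 q k

      N : ℕ
      N = n / q ^ k

      j≡ : ∀ j → j ≡ j % q ^ k + (j / q ^ k) * q ^ k
      j≡ j = m≡m%n+[m/n]*n j (q ^ k)

      from-digits-≤ : ∀ {j} → q ^ k * digitSum N + (j % q ^ k + (j / q ^ k) * q ^ k) ≤ q ^ k * digitSum (j % q ^ k + (j / q ^ k) * q ^ k) + vertex k →
                      q ^ k * digitSum (vertex k) + j ≤ q ^ k * digitSum j + vertex k
      from-digits-≤ {j} = subst₂ _≤_ (cong₂ (λ s i → q ^ k * s + i) (sym (digitSum-*q^ k N)) (sym (j≡ j))) (cong (λ i → q ^ k * digitSum i + vertex k) (sym (j≡ j)))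

      from-digits-< : ∀ {j} → q ^ k * digitSum N + (j % q ^ k + (j / q ^ k) * q ^ k) < q ^ k * digitSum (j % q ^ k + (j / q ^ k) * q ^ k) + vertex k →
                      q ^ k * digitSum (vertex k) + j < q ^ k * digitSum j + vertex k
      from-digits-< {j} = subst₂ _<_ (cong₂ (λ s i → q ^ k * s + i) (sym (digitSum-*q^ k N)) (sym (j≡ j))) (cong (λ i → q ^ k * digitSum i + vertex k) (sym (j≡ j)))

    hull-≤ : ∀ {j} → j ≤ n → q ^ k * digitSum (vertex k) + j ≤ q ^ k * digitSum j + vertex k
    hull-≤ {j} j≤n = from-digits-≤ (digitSum-hull-≤ k (m%n<n j (q ^ k)) (/-monoˡ-≤ (q ^ k) j≤n))

    hull-<-right : ∀ {j} → vertex k < j → j ≤ n → q ^ k * digitSum (vertex k) + j < q ^ k * digitSum j + vertex k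
    hull-<-right {j} vertex<j j≤n = from-digits-< (digitSum-hull-< k (m%n<n j (q ^ k)) (inj₁ (0<t , M≤N)))
      where
      M≤N : j / q ^ k ≤ N
      M≤N = /-monoˡ-≤ (q ^ k) j≤n
      N≤M : N ≤ j / q ^ k
      N≤M = subst (_≤ j / q ^ k) (m*n/n≡m N (q ^ k)) (/-monoˡ-≤ (q ^ k) (<⇒≤ vertex<j))
      0<t : 0 < j % q ^ k
      0<t = n≢0⇒n>0 λ t≡0 → <-irrefl (sym (trans (j≡ j) (cong₂ (λ t M → t + M * q ^ k) t≡0 (≤-antisym M≤N N≤M)))) vertex<j

    hull-<-left : ∀ {j} → j < vertex (suc k) → q ^ k * digitSum (vertex k) + j < q ^ k * digitSum j + vertex k
    hull-<-left {j} j<vertex′ = from-digits-< (digitSum-hull-< k (m%n<n j (q ^ k)) strictly)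
      where
      N′ : ℕ
      N′ = N / q * q
      j<N′q^k : j < N′ * q ^ k
      j<N′q^k = subst (j <_) (vertex-suc k) j<vertex′
      N′≤N : N′ ≤ N
      N′≤N = m/n*n≤m N q
      strictly : (0 < j % q ^ k × j / q ^ k ≤ N) ⊎ ν ((j / q ^ k) !) < ν (N !)
      strictly with j % q ^ k ≟ 0
      ... | no t≢0 = inj₁ (n≢0⇒n>0 t≢0 , ≤-trans (subst (j / q ^ k ≤_) (m*n/n≡m N′ (q ^ k)) (/-monoˡ-≤ (q ^ k) (<⇒≤ j<N′q^k))) N′≤N)
      ... | yes t≡0 = inj₂ (ν[!]-mono-< (*-cancelʳ-< (q ^ k) (j / q ^ k) N′ (subst (_< N′ * q ^ k) (trans (j≡ j) (cong (_+ (j / q ^ k) * q ^ k) t≡0)) j<N′q^k))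
                                        N′≤N (n∣m*n (N / q)))

    hull-≡ : q ^ k * digitSum (vertex k) + vertex (suc k) ≡ q ^ k * digitSum (vertex (suc k)) + vertex k
    hull-≡ = subst (λ J′ → q ^ k * digitSum (vertex k) + J′ ≡ q ^ k * digitSum J′ + vertex k) (sym (vertex-suc k)) (digitSum-hull-≡ k N)

  private
    weight-at-vertex-≤ : ∀ k {j} → c j ≢ 0ℚ → q ^ k * digitSum (vertex k) + j ≤ q ^ k * digitSum j + vertex k →
                         weight (slopeA k) (slopeB k) c (vertex k) ℤ.≤ weight (slopeA k) (slopeB k) c j
    weight-at-vertex-≤ k {j} cj≢0 hull = subst₂ ℤ._≤_ (sym (weight≡height k (vertex≤n k))) (sym (weight≡height k (c≢0⇒≤n cj≢0)))
      (m+p≤n+o⇒m-o≤n-p {height k (vertex k)} {height k j} {vertex k} {j} (subst (λ E → E + j ≤ height k j + vertex k) (sym (height[vertex] k k))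
                (≤-trans hull (+-monoˡ-≤ (vertex k) (m≤m+n (q ^ k * digitSum j) (slopeB k * ν (binom j)))))))

    weight-at-vertex-< : ∀ k {j} → c j ≢ 0ℚ → q ^ k * digitSum (vertex k) + j < q ^ k * digitSum j + vertex k →
                         weight (slopeA k) (slopeB k) c (vertex k) ℤ.< weight (slopeA k) (slopeB k) c j
    weight-at-vertex-< k {j} cj≢0 hull = subst₂ ℤ._<_ (sym (weight≡height k (vertex≤n k))) (sym (weight≡height k (c≢0⇒≤n cj≢0)))
      (m+p<n+o⇒m-o<n-p {height k (vertex k)} {height k j} {vertex k} {j} (subst (λ E → E + j < height k j + vertex k) (sym (height[vertex] k k))
                (<-≤-trans hull (+-monoˡ-≤ (vertex k) (m≤m+n (q ^ k * digitSum j) (slopeB k * ν (binom j)))))))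

    weight-at-vertex-suc : ∀ k → weight (slopeA k) (slopeB k) c (vertex (suc k)) ≡ weight (slopeA k) (slopeB k) c (vertex k)
    weight-at-vertex-suc k = trans (weight≡height k (vertex≤n (suc k)))
      (trans (m+p≡n+o⇒m-o≡n-p {height k (vertex (suc k))} {height k (vertex k)} {vertex (suc k)} {vertex k} heights)
             (sym (weight≡height k (vertex≤n k))))
      where
      heights : height k (vertex (suc k)) + vertex k ≡ height k (vertex k) + vertex (suc k)
      heights = subst₂ (λ E E′ → E′ + vertex k ≡ E + vertex (suc k))
                       (sym (height[vertex] k k)) (sym (height[vertex] k (suc k))) (sym (hull-≡ k))

  c-right-end : ∀ k → IsEnd right (slopeA k) (slopeB k) c (vertex k)
  c-right-end k = record
    { nonzero = c[vertex]≢0 k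
    ; minimal = λ j cj≢0 → weight-at-vertex-≤ k cj≢0 (hull-≤ k (c≢0⇒≤n cj≢0))
    ; strict = λ j vertex<j cj≢0 → weight-at-vertex-< k cj≢0 (hull-<-right k vertex<j (c≢0⇒≤n cj≢0))
    }

  c-left-end : ∀ k → IsEnd left (slopeA k) (slopeB k) c (vertex (suc k))
  c-left-end k = record
    { nonzero = c[vertex]≢0 (suc k)
    ; minimal = λ j cj≢0 → subst (ℤ._≤ weight (slopeA k) (slopeB k) c j) (sym (weight-at-vertex-suc k)) (IsEnd.minimal (c-right-end k) j cj≢0)
    ; strict = λ j j<vertex′ cj≢0 → subst (ℤ._< weight (slopeA k) (slopeB k) c j) (sym (weight-at-vertex-suc k))
                                      (weight-at-vertex-< k cj≢0 (hull-<-left k j<vertex′))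
    }

  steeper : ∀ k → slopeA k * slopeB (suc k) < slopeA (suc k) * slopeB k
  steeper k = subst₂ (λ q′ Q → (Q ∸ 1) * (q-1 * (q′ * Q)) < (q′ * Q ∸ 1) * (q-1 * Q)) suc[q-1]≡q (m+[n∸m]≡n (m^n>0 q k))
                (gap q-1 (q ^ k ∸ 1) 1≤q-1)
    where
    ring : ∀ P a → a * (P * (suc P * suc a)) + P * (P * suc a) ≡ (a + P * suc a) * (P * suc a)
    ring = solve-∀
    gap : ∀ P a → 1 ≤ P → a * (P * (suc P * suc a)) < (suc P * suc a ∸ 1) * (P * suc a)
    gap P a 1≤P = subst (a * (P * (suc P * suc a)) <_) (ring P a)
                    (m<m+n _ (*-mono-≤ 1≤P (*-mono-≤ 1≤P (s≤s z≤n))))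

  slopeB∣⇒q^k∣ : ∀ k {d} → slopeB k ∣ slopeA k * d → q ^ k ∣ d
  slopeB∣⇒q^k∣ k {d} B∣Ad = ∣m+n∣m⇒∣n q^k∣Ad+d (∣-trans (n∣m*n q-1) B∣Ad)
    where
    q^k∣Ad+d : q ^ k ∣ slopeA k * d + d
    q^k∣Ad+d = divides d (trans (+-comm (slopeA k * d) d) (trans (cong (_* d) (m+[n∸m]≡n (m^n>0 q k))) (*-comm (q ^ k) d)))

  private
    n<q^n : ∀ m → m < q ^ m
    n<q^n zero = s≤s z≤n
    n<q^n (suc m) = <-≤-trans (s≤s (n<q^n m)) (subst (suc (q ^ m) ≤_) (*-comm (q ^ m) q) (m<m*n (q ^ m) q {{m^n≢0 q m}} 1<q))

    module Telescope {X Y : ℕ → ℚ} {RX LX RY LY : ℕ → ℕ}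
      (eXᵣ : ∀ k → IsEnd right (slopeA k) (slopeB k) X (RX k)) (eXₗ : ∀ k → IsEnd left (slopeA k) (slopeB k) X (LX k))
      (eYᵣ : ∀ k → IsEnd right (slopeA k) (slopeB k) Y (RY k)) (eYₗ : ∀ k → IsEnd left (slopeA k) (slopeB k) Y (LY k))
      (sumᵣ : ∀ k → RX k + RY k ≡ vertex k) (sumₗ : ∀ k → LX k + LY k ≡ vertex (suc k)) where

      chained : ∀ k → LX k ≡ RX (suc k)
      chained k = squeeze (trans (sumₗ k) (sym (sumᵣ (suc k))))
                          (right≤left (steeper k) (eXₗ k) (eXᵣ (suc k))) (right≤left (steeper k) (eYₗ k) (eYᵣ (suc k)))

      q^e∣RX : ∀ e → q ^ e ∣ RX e
      q^e∣RX e = subst (q ^ e ∣_) (cong RX (+-identityʳ e))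
        (∣-telescope (λ t → RX (e + t)) (λ t → LX (e + t))
          (λ t → left≤right (eXₗ (e + t)) (eXᵣ (e + t)))
          (λ t → trans (chained (e + t)) (cong RX (sym (+-suc e t))))
          (λ t → ∣-trans (q^-mono-∣ (m≤m+n e t)) (slopeB∣⇒q^k∣ (e + t) (edge-divisible (eXₗ (e + t)) (eXᵣ (e + t)))))
          (suc n) (subst (q ^ e ∣_) (sym RX≡0) ((q ^ e) ∣0)))
        where
        RX≡0 : RX (e + suc n) ≡ 0
        RX≡0 = m+n≡0⇒m≡0 (RX (e + suc n)) (trans (sumᵣ (e + suc n))
                 (vertex-beyond (e + suc n) (<-≤-trans (n<q^n n) (^-monoʳ-≤ q (≤-trans (n≤1+n n) (m≤n+m (suc n) e))))))

  q^e∣factor-degrees : ∀ {G H dG dH e} → (∀ j → c j ≡ (G ⋆ H) j) → IsDegree G dG → IsDegree H dH → q ^ e ∣ n →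
                       q ^ e ∣ dG × q ^ e ∣ dH
  q^e∣factor-degrees {G} {H} {dG} {dH} {e} c≗G⋆H degG degH q^e∣n =
    subst (q ^ e ∣_) RG[e]≡dG (G-side.q^e∣RX e) , subst (q ^ e ∣_) RH[e]≡dH (H-side.q^e∣RX e)
    where
    eGᵣ : ∀ k → ∃ (IsEnd right (slopeA k) (slopeB k) G)
    eGᵣ k = end-exists-of-degree right (slopeA k) (slopeB k) degG
    eGₗ : ∀ k → ∃ (IsEnd left (slopeA k) (slopeB k) G)
    eGₗ k = end-exists-of-degree left (slopeA k) (slopeB k) degG
    eHᵣ : ∀ k → ∃ (IsEnd right (slopeA k) (slopeB k) H)
    eHᵣ k = end-exists-of-degree right (slopeA k) (slopeB k) degH
    eHₗ : ∀ k → ∃ (IsEnd left (slopeA k) (slopeB k) H)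
    eHₗ k = end-exists-of-degree left (slopeA k) (slopeB k) degH
    sumᵣ : ∀ k → proj₁ (eGᵣ k) + proj₁ (eHᵣ k) ≡ vertex k
    sumᵣ k = ends-of-factors c≗G⋆H (proj₂ (eGᵣ k)) (proj₂ (eHᵣ k)) (c-right-end k)
    sumₗ : ∀ k → proj₁ (eGₗ k) + proj₁ (eHₗ k) ≡ vertex (suc k)
    sumₗ k = ends-of-factors c≗G⋆H (proj₂ (eGₗ k)) (proj₂ (eHₗ k)) (c-left-end k)
    module G-side = Telescope (proj₂ ∘ eGᵣ) (proj₂ ∘ eGₗ) (proj₂ ∘ eHᵣ) (proj₂ ∘ eHₗ) sumᵣ sumₗ
    module H-side = Telescope (proj₂ ∘ eHᵣ) (proj₂ ∘ eHₗ) (proj₂ ∘ eGᵣ) (proj₂ ∘ eGₗ)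
                              (λ k → trans (+-comm (proj₁ (eHᵣ k)) (proj₁ (eGᵣ k))) (sumᵣ k)) (λ k → trans (+-comm (proj₁ (eHₗ k)) (proj₁ (eGₗ k))) (sumₗ k))
    dG+dH≡n : dG + dH ≡ n
    dG+dH≡n = degrees-of-factors c≗G⋆H degG degH
    ends[e] : proj₁ (eGᵣ e) + proj₁ (eHᵣ e) ≡ dG + dH
    ends[e] = trans (sumᵣ e) (trans (vertex-of-divisor e q^e∣n) (sym dG+dH≡n))
    RG[e]≡dG : proj₁ (eGᵣ e) ≡ dG
    RG[e]≡dG = sym (squeeze (sym ends[e]) (≤-degree degG (IsEnd.nonzero (proj₂ (eGᵣ e)))) (≤-degree degH (IsEnd.nonzero (proj₂ (eHᵣ e)))))
    RH[e]≡dH : proj₁ (eHᵣ e) ≡ dH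
    RH[e]≡dH = sym (squeeze (trans (+-comm dH dG) (sym (trans (+-comm (proj₁ (eHᵣ e)) (proj₁ (eGᵣ e))) ends[e])))
                            (≤-degree degH (IsEnd.nonzero (proj₂ (eHᵣ e)))) (≤-degree degG (IsEnd.nonzero (proj₂ (eGᵣ e)))))

prime-divisor : ∀ {a} → 1 < a → ∃ λ q → Prime q × q ∣ a
prime-divisor {a@(suc _)} 1<a with PrimeFactorisation.factors (factorise a) | PrimeFactorisation.isFactorisation (factorise a)
                                 | PrimeFactorisation.factorsPrime (factorise a)
... | [] | a≡1 | _ = contradiction (sym a≡1) (<⇒≢ 1<a)
... | q ∷ qs | a≡q*qs | q-prime ∷ _ = q , q-prime , divides (product qs) (trans a≡q*qs (*-comm q (product qs)))

prime-powers-∣⇒∣ : ∀ a {d} .{{_ : NonZero a}} → (∀ q e → Prime q → q ^ e ∣ a → q ^ e ∣ d) → a ∣ d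
prime-powers-∣⇒∣ = <-rec _ step
  where
  step : ∀ a → (∀ {a′} → a′ < a → ∀ {d} .{{_ : NonZero a′}} → (∀ q e → Prime q → q ^ e ∣ a′ → q ^ e ∣ d) → a′ ∣ d) →
         ∀ {d} .{{_ : NonZero a}} → (∀ q e → Prime q → q ^ e ∣ a → q ^ e ∣ d) → a ∣ d
  step 1 _ {d} _ = 1∣ d
  step a@(2+ _) rec {d} prime-powers with prime-divisor {a} (s≤s (s≤s z≤n))
  ... | q , q-prime , q∣a with Valuation.ν-split q-prime a
  ...   | u , a≡q^ν*u , q∤u = a∣d
    where
    open Valuation q-prime
    instance
      u≢0 : NonZero u
      u≢0 = m*n≢0⇒n≢0 (q ^ ν a) {{subst NonZero a≡q^ν*u _}}
    u∣a : u ∣ a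
    u∣a = divides (q ^ ν a) a≡q^ν*u
    u<a : u < a
    u<a = subst (u <_) (trans (*-comm u (q ^ ν a)) (sym a≡q^ν*u))
            (m<m*n u (q ^ ν a) (<-≤-trans 1<q (subst (_≤ q ^ ν a) (*-identityʳ q) (^-monoʳ-≤ q (q^k∣⇒k≤ν {k = 1} (subst (_∣ a) (sym (*-identityʳ q)) q∣a))))))
    u∣d : u ∣ d
    u∣d = rec u<a (λ q′ e q′-prime q′^e∣u → prime-powers q′ e q′-prime (∣-trans q′^e∣u u∣a))
    a∣d : a ∣ d
    a∣d with u∣d
    ... | divides zero refl = a ∣0
    ... | divides w@(suc _) refl = subst (_∣ w * u) (sym a≡q^ν*u) (*-monoˡ-∣ u q^ν∣w)
      where
      νa≤νw : ν a ≤ ν w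
      νa≤νw = subst (ν a ≤_) (trans (ν-* w u) (trans (cong (λ z → ν w + z) (ν≡0 q∤u)) (+-identityʳ (ν w))))
                (q^k∣⇒k≤ν {{m*n≢0 w u}} (prime-powers q (ν a) q-prime (q^ν∣ a)))
      q^ν∣w : q ^ ν a ∣ w
      q^ν∣w = ∣-trans (q^-mono-∣ νa≤νw) (q^ν∣ w)

cofactor-degree-< : ∀ {n n₀ p dG dH} → dG + dH ≡ n → p ≤ dG → n ∸ n₀ < p → dH < n₀
cofactor-degree-< {n} {n₀} {p} {dG} {dH} dG+dH≡n p≤dG n∸n₀<p = ≰⇒> λ n₀≤dH →
  <⇒≱ n∸n₀<p (≤-trans p≤dG (subst (_≤ n ∸ n₀) (trans (cong (_∸ dH) (sym dG+dH≡n)) (m+n∸n≡m dG dH)) (∸-monoʳ-≤ n n₀≤dH)))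

small-degree⇒IsConstant : ∀ {f m d} → IsDegree (coeff f) d → m ∣ d → d < m → IsConstant f
small-degree⇒IsConstant {d = zero} (_ , above) _ _ = above
small-degree⇒IsConstant {d = suc _} _ m∣d d<m = contradiction (∣⇒≤ m∣d) (<⇒≱ d<m)

module _ {n r n₀ : ℕ} .{{_ : NonZero n₀}} (n₀∣n : n₀ ∣ n) (n₀⊥C : Coprime n₀ ((n + r) C r)) where

  n₀∣factor-degrees : ∀ {G H dG dH} → (∀ j → coeff (L n r) j ≡ (G ⋆ H) j) → IsDegree G dG → IsDegree H dH →
                      n₀ ∣ dG × n₀ ∣ dH
  n₀∣factor-degrees {G} {H} {dG} {dH} c≗G⋆H degG degH =
    prime-powers-∣⇒∣ n₀ (λ q e q-prime q^e∣n₀ → proj₁ (prime-power-∣ q e q-prime q^e∣n₀)) ,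
    prime-powers-∣⇒∣ n₀ (λ q e q-prime q^e∣n₀ → proj₂ (prime-power-∣ q e q-prime q^e∣n₀))
    where
    prime-power-∣ : ∀ q e → Prime q → q ^ e ∣ n₀ → q ^ e ∣ dG × q ^ e ∣ dH
    prime-power-∣ q zero _ _ = 1∣ dG , 1∣ dH
    prime-power-∣ q (suc e) q-prime q^[1+e]∣n₀ =
      CoprimePrime.q^e∣factor-degrees q-prime q∤C {e = suc e} c≗G⋆H degG degH (∣-trans q^[1+e]∣n₀ n₀∣n)
      where
      q∤C : ¬ q ∣ (n + r) C r
      q∤C q∣C = <⇒≢ (Valuation.1<q q-prime) (sym (n₀⊥C (∣-trans (m∣m*n (q ^ e)) q^[1+e]∣n₀ , q∣C)))

lemma4p1 : (n r n₀ : ℕ) → 1 ≤ n → IsLargestCoprimeDivisor n r n₀ →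
    (∃ λ p → Prime p × n + r < 2 * p × n ∸ n₀ < p × p ≤ n) →
    Irreducible (L n r)
lemma4p1 n r n₀ 1≤n (n₀∣n , n₀⊥C , _) (p , p-prime , n+r<2p , n∸n₀<p , p≤n) =
  (n , 1≤n , proj₁ (IsDegree-L n r)) , only-trivial-factorisations
  where
  instance
    n₀≢0 : NonZero n₀
    n₀≢0 = ≢-nonZero λ { refl → contradiction (0∣⇒≡0 n₀∣n) (≢-nonZero⁻¹ n {{>-nonZero 1≤n}}) }
  open Newton p-prime using (factor-degrees)
  open CoefficientsOfL p-prime using (degrees-of-factors)

  only-trivial-factorisations : ∀ g h → L n r ≈ₚ (g *ₚ h) → IsConstant g ⊎ IsConstant h
  only-trivial-factorisations g h L≈g*h =
    from-degrees (factor-degrees (length g) (length h) c≗G⋆H (IsDegree-L n r) (λ _ → coeff-≥length g) (λ _ → coeff-≥length h))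
    where
    c≗G⋆H : ∀ j → coeff (L n r) j ≡ (coeff g ⋆ coeff h) j
    c≗G⋆H j = trans (L≈g*h j) (coeff-*ₚ g h j)
    from-degrees : ∃ (IsDegree (coeff g)) × ∃ (IsDegree (coeff h)) → IsConstant g ⊎ IsConstant h
    from-degrees ((dG , degG) , (dH , degH)) =
      [ (λ p≤dG → inj₂ (small-degree⇒IsConstant {h} degH (proj₂ n₀∣) (cofactor-degree-< dG+dH≡n p≤dG n∸n₀<p)))
      , (λ p≤dH → inj₁ (small-degree⇒IsConstant {g} degG (proj₁ n₀∣) (cofactor-degree-< (trans (+-comm dH dG) dG+dH≡n) p≤dH n∸n₀<p))) ]′
      (LargePrime.large-factor p-prime n+r<2p p≤n c≗G⋆H degG degH)
      where
      n₀∣ : n₀ ∣ dG × n₀ ∣ dH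
      n₀∣ = n₀∣factor-degrees n₀∣n n₀⊥C c≗G⋆H degG degH
      dG+dH≡n : dG + dH ≡ n
      dG+dH≡n = degrees-of-factors c≗G⋆H degG degH
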